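{- For any fixed nonnegative integers $p,h$ and any positive integer $\Delta$, there exists an infinite family of instances of problem (M), each given together with a vertex solution of its LP relaxation, such that every integral feasible solution (in particular the nearest one) is at $\infty$-norm distance $\Omega(m\cdot(\Delta m)^{p+h})$ from that LP vertex solution. These instances satisfy $m=\Theta(n)$, $l=\mathbf 0$, $u=\boldsymbol\infty$ (no upper bounds on $x$), and all constraint matrix coefficients lie in $\{0,1,\Delta\}$.
   Context: Problem (M) is $\min\{a^\top y+c^\top x\mid Cy+Wx=d,\ Ty+Mx=b,\ e\le y\le g,\ l\le x\le u,\ (y,x)\in\mathbb Z^{p+n}\}$ with $C\in\mathbb Z^{h\times p}$, $W\in\mathbb Z^{h\times n}$, $T\in\mathbb Z^{m\times p}$, $M\in\mathbb Z^{m\times n}$ whose columns each have $1$-norm at most $2$. The LP relaxation drops integrality. The constant hidden in the $\Omega$ may depend on $p,h$ (it is of order $1/(p+h)^{p+h+1}$). -}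

module Defs where

open import Data.Nat as ℕ using (ℕ; zero; suc)
open import Data.Fin using (Fin; zero; suc)
open import Data.Integer as ℤ using (ℤ; +_)
open import Data.Rational as ℚ using (ℚ; _/_; 0ℚ; 1ℚ)
open import Data.Product using (_×_; Σ; _,_)
open import Data.Sum using (_⊎_)
open import Data.Maybe using (Maybe; just; nothing)
open import Relation.Binary.PropositionalEquality using (_≡_; _≢_)

ι : ℤ → ℚ
ι z = z / 1

Σℤ : (k : ℕ) → (Fin k → ℤ) → ℤ
Σℤ zero    f = + 0
Σℤ (suc k) f = f zero ℤ.+ Σℤ k (λ i → f (suc i))

Σℚ : (k : ℕ) → (Fin k → ℚ) → ℚ
Σℚ zero    f = 0ℚ
Σℚ (suc k) f = f zero ℚ.+ Σℚ k (λ i → f (suc i))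

maxℚ : (k : ℕ) → (Fin k → ℚ) → ℚ
maxℚ zero    f = 0ℚ
maxℚ (suc k) f = f zero ℚ.⊔ maxℚ k (λ i → f (suc i))

Vecℤ : ℕ → Set
Vecℤ k = Fin k → ℤ

Vecℚ : ℕ → Set
Vecℚ k = Fin k → ℚ

Matℤ : ℕ → ℕ → Set
Matℤ r c = Fin r → Fin c → ℤ

-- An instance of problem (M) with fixed p (integer y-variables) and h
-- (coupling rows); m rows of T,M, n x-variables.
--   min a·y + c·x  s.t.  C y + W x = d,  T y + M x = b,  e ≤ y ≤ g,
--                        l ≤ x ≤ u,  (y,x) integral.
-- Upper bounds on x are optional (nothing = +∞).
record Instance (p h m n : ℕ) : Set where
  field
    a : Vecℤ p
    c : Vecℤ n
    C : Matℤ h p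
    W : Matℤ h n
    T : Matℤ m p
    M : Matℤ m n
    d : Vecℤ h
    b : Vecℤ m
    e : Vecℤ p
    g : Vecℤ p
    l : Vecℤ n
    u : Fin n → Maybe ℤ

open Instance public

Point : ℕ → ℕ → Set
Point p n = Vecℚ p × Vecℚ n

record LPFeasible {p h m n : ℕ} (I : Instance p h m n) (z : Point p n) : Set where
  constructor lpFeasible
  field
    eqCW  : ∀ (i : Fin h) →
      Σℚ p (λ j → ι (C I i j) ℚ.* Data.Product.proj₁ z j)
        ℚ.+ Σℚ n (λ k → ι (W I i k) ℚ.* Data.Product.proj₂ z k) ≡ ι (d I i)
    eqTM  : ∀ (i : Fin m) →
      Σℚ p (λ j → ι (T I i j) ℚ.* Data.Product.proj₁ z j)
        ℚ.+ Σℚ n (λ k → ι (M I i k) ℚ.* Data.Product.proj₂ z k) ≡ ι (b I i)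
    lowY  : ∀ (j : Fin p) → ι (e I j) ℚ.≤ Data.Product.proj₁ z j
    uppY  : ∀ (j : Fin p) → Data.Product.proj₁ z j ℚ.≤ ι (g I j)
    lowX  : ∀ (k : Fin n) → ι (l I k) ℚ.≤ Data.Product.proj₂ z k
    uppX  : ∀ (k : Fin n) (v : ℤ) → u I k ≡ just v → Data.Product.proj₂ z k ℚ.≤ ι v

IntPoint : ℕ → ℕ → Set
IntPoint p n = Vecℤ p × Vecℤ n

embed : {p n : ℕ} → IntPoint p n → Point p n
embed (y , x) = (λ j → ι (y j)) , (λ k → ι (x k))

IntFeasible : {p h m n : ℕ} → Instance p h m n → IntPoint p n → Set
IntFeasible I w = LPFeasible I (embed w)

half : ℚ
half = + 1 / 2

IsMidpoint : {p n : ℕ} → Point p n → Point p n → Point p n → Set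
IsMidpoint {p} {n} z z₁ z₂ =
  (∀ (j : Fin p) → Data.Product.proj₁ z j ≡ half ℚ.* (Data.Product.proj₁ z₁ j ℚ.+ Data.Product.proj₁ z₂ j)) ×
  (∀ (k : Fin n) → Data.Product.proj₂ z k ≡ half ℚ.* (Data.Product.proj₂ z₁ k ℚ.+ Data.Product.proj₂ z₂ k))

SamePoint : {p n : ℕ} → Point p n → Point p n → Set
SamePoint {p} {n} z₁ z₂ =
  (∀ (j : Fin p) → Data.Product.proj₁ z₁ j ≡ Data.Product.proj₁ z₂ j) ×
  (∀ (k : Fin n) → Data.Product.proj₂ z₁ k ≡ Data.Product.proj₂ z₂ k)

IsLPVertex : {p h m n : ℕ} → Instance p h m n → Point p n → Set
IsLPVertex {p} {h} {m} {n} I z =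
  LPFeasible I z ×
  (∀ (z₁ z₂ : Point p n) → LPFeasible I z₁ → LPFeasible I z₂ →
     IsMidpoint z z₁ z₂ → SamePoint z₁ z₂)

dist∞ : {p n : ℕ} → Point p n → Point p n → ℚ
dist∞ {p} {n} (y , x) (y' , x') =
  maxℚ p (λ j → ℚ.∣ y j ℚ.- y' j ∣) ℚ.⊔ maxℚ n (λ k → ℚ.∣ x k ℚ.- x' k ∣)

In01Δ : ℕ → ℤ → Set
In01Δ Δ z = (z ≡ + 0) ⊎ ((z ≡ + 1) ⊎ (z ≡ + Δ))

CoeffsIn01Δ : {p h m n : ℕ} → ℕ → Instance p h m n → Set
CoeffsIn01Δ {p} {h} {m} {n} Δ I =
  (∀ (i : Fin h) (j : Fin p) → In01Δ Δ (C I i j)) ×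
  (∀ (i : Fin h) (k : Fin n) → In01Δ Δ (W I i k)) ×
  (∀ (i : Fin m) (j : Fin p) → In01Δ Δ (T I i j)) ×
  (∀ (i : Fin m) (k : Fin n) → In01Δ Δ (M I i k))

MColumnsNorm≤2 : {p h m n : ℕ} → Instance p h m n → Set
MColumnsNorm≤2 {p} {h} {m} {n} I =
  ∀ (k : Fin n) → Σℤ m (λ i → + ℤ.∣ M I i k ∣) ℤ.≤ + 2

ZeroLowerNoUpper : {p h m n : ℕ} → Instance p h m n → Set
ZeroLowerNoUpper {p} {h} {m} {n} I =
  (∀ (k : Fin n) → l I k ≡ + 0) × (∀ (k : Fin n) → u I k ≡ nothing)

ℕ→ℚ : ℕ → ℚ
ℕ→ℚ k = + k / 1

module Submission where

-- Call an instance hard with gap D if some LP vertex has a pivot coordinate equal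
-- to D while every integral feasible point has pivot coordinate 0.  The base instance
-- is k disjoint odd cycles (gap k).  Each new integer variable and each new coupling row
-- is a gadget of O(k) rows and columns, with coefficients 0, 1 and Δ, through which the
-- old pivot value propagates to a new pivot whose gap is kΔ times the old one.  After
-- p + h steps m and n are Θ(k) while the gap is k (Δk)^(p+h) = Ω(m (Δm)^(p+h)).

open import Defs
open import Data.Nat using (ℕ; _+_; _*_; _^_; _≤_)
open import Data.Rational using (ℚ; 0ℚ) renaming (_*_ to _*ℚ_; _≤_ to _≤ℚ_; _<_ to _<ℚ_)
open import Data.Product using (Σ; _×_; _,_)

open import Data.Empty using (⊥-elim)
open import Data.Fin as Fin using (Fin; zero; suc; _↑ˡ_; _↑ʳ_; splitAt; join)
open import Data.Fin.Induction using (<-weakInduction)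
import Data.Fin.Properties as Finₚ
open import Data.Integer as ℤ using (ℤ; +_; -[1+_])
import Data.Integer.Properties as ℤₚ
open import Data.Maybe using (just; nothing)
open import Data.Nat as ℕ using (zero; suc)
import Data.Nat.Properties as ℕₚ
open import Data.Nat.Coprimality as Coprimality using (Coprime)
open import Data.Nat.Solver using (module +-*-Solver)
open import Data.Rational as ℚ using (mkℚ; 1ℚ)
import Data.Rational.Properties as ℚₚ
open import Data.Product using (proj₁; proj₂)
open import Data.Sum using (_⊎_; inj₁; inj₂)
open import Data.Vec.Functional using (_++_; _∷_)
open import Data.Vec.Functional.Properties using (lookup-++ˡ; lookup-++ʳ)
open import Relation.Binary.PropositionalEquality
open import Relation.Nullary using (yes; no)
open import Algebra.Properties.AbelianGroup ℤₚ.+-0-abelianGroup using (x≈z//y)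
open import Algebra.Properties.CommutativeSemigroup ℕₚ.*-commutativeSemigroup using (x∙yz≈y∙xz; interchange)
open import Algebra.Properties.Group ℚₚ.+-0-group using (∙-cancelˡ; ∙-cancelʳ)

coprime-1 : ∀ n → Coprime n 1
coprime-1 n = Coprimality.sym (Coprimality.1-coprimeTo n)

ι-mkℚ : ∀ z → ι z ≡ mkℚ z 0 (coprime-1 ℤ.∣ z ∣)
ι-mkℚ (+ n)    = ℚₚ.normalize-coprime (coprime-1 n)
ι-mkℚ -[1+ n ] = cong ℚ.-_ (ℚₚ.normalize-coprime (coprime-1 (suc n)))

ι-homo-+ : ∀ a b → ι (a ℤ.+ b) ≡ ι a ℚ.+ ι b
ι-homo-+ a b = begin
  ι (a ℤ.+ b)
    ≡⟨ cong ι (sym (cong₂ ℤ._+_ (ℤₚ.*-identityʳ a) (ℤₚ.*-identityʳ b))) ⟩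
  ι (a ℤ.* + 1 ℤ.+ b ℤ.* + 1)
    ≡⟨⟩
  mkℚ a 0 (coprime-1 ℤ.∣ a ∣) ℚ.+ mkℚ b 0 (coprime-1 ℤ.∣ b ∣)
    ≡⟨ sym (cong₂ ℚ._+_ (ι-mkℚ a) (ι-mkℚ b)) ⟩
  ι a ℚ.+ ι b ∎
  where open ≡-Reasoning

ι-homo-* : ∀ a b → ι (a ℤ.* b) ≡ ι a ℚ.* ι b
ι-homo-* a b = begin
  ι (a ℤ.* b)
    ≡⟨⟩
  mkℚ a 0 (coprime-1 ℤ.∣ a ∣) ℚ.* mkℚ b 0 (coprime-1 ℤ.∣ b ∣)
    ≡⟨ sym (cong₂ ℚ._*_ (ι-mkℚ a) (ι-mkℚ b)) ⟩
  ι a ℚ.* ι b ∎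
  where open ≡-Reasoning

ι-injective : ∀ {a b} → ι a ≡ ι b → a ≡ b
ι-injective {a} {b} eq =
  trans (cong ℚ.↥_ (sym (ι-mkℚ a))) (trans (cong ℚ.↥_ eq) (cong ℚ.↥_ (ι-mkℚ b)))

ι-mono-≤ : ∀ {a b} → a ℤ.≤ b → ι a ℚ.≤ ι b
ι-mono-≤ {a} {b} a≤b rewrite ι-mkℚ a | ι-mkℚ b =
  ℚ.*≤* (subst₂ ℤ._≤_ (sym (ℤₚ.*-identityʳ a)) (sym (ℤₚ.*-identityʳ b)) a≤b)

ι-cancel-≤ : ∀ {a b} → ι a ℚ.≤ ι b → a ℤ.≤ b
ι-cancel-≤ {a} {b} ιa≤ιb rewrite ι-mkℚ a | ι-mkℚ b with ιa≤ιb
... | ℚ.*≤* a≤b = subst₂ ℤ._≤_ (ℤₚ.*-identityʳ a) (ℤₚ.*-identityʳ b) a≤b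

0≤ι+ : ∀ n → 0ℚ ℚ.≤ ι (+ n)
0≤ι+ n = ι-mono-≤ {+ 0} {+ n} (ℤ.+≤+ ℕ.z≤n)

0<ι+suc : ∀ n → 0ℚ ℚ.< ι (+ suc n)
0<ι+suc n = subst (0ℚ ℚ.<_) (sym (ι-mkℚ (+ suc n))) (ℚ.*<* (ℤ.+<+ (ℕ.s≤s ℕ.z≤n)))

ι-homo-ℕ* : ∀ a b → ι (+ (a ℕ.* b)) ≡ ι (+ a) ℚ.* ι (+ b)
ι-homo-ℕ* a b = trans (cong ι (ℤₚ.pos-* a b)) (ι-homo-* (+ a) (+ b))

Σℚ-cong : ∀ k {f g : Fin k → ℚ} → (∀ i → f i ≡ g i) → Σℚ k f ≡ Σℚ k g
Σℚ-cong zero    f≗g = refl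
Σℚ-cong (suc k) f≗g = cong₂ ℚ._+_ (f≗g zero) (Σℚ-cong k (λ i → f≗g (suc i)))

Σℤ-cong : ∀ k {f g : Fin k → ℤ} → (∀ i → f i ≡ g i) → Σℤ k f ≡ Σℤ k g
Σℤ-cong zero    f≗g = refl
Σℤ-cong (suc k) f≗g = cong₂ ℤ._+_ (f≗g zero) (Σℤ-cong k (λ i → f≗g (suc i)))

Σℚ-++ : ∀ a b (f : Fin (a + b) → ℚ) →
  Σℚ (a + b) f ≡ Σℚ a (λ i → f (i ↑ˡ b)) ℚ.+ Σℚ b (λ j → f (a ↑ʳ j))
Σℚ-++ zero    b f = sym (ℚₚ.+-identityˡ _)
Σℚ-++ (suc a) b f =
  trans (cong (f zero ℚ.+_) (Σℚ-++ a b (λ i → f (suc i)))) (sym (ℚₚ.+-assoc (f zero) _ _))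

Σℤ-++ : ∀ a b (f : Fin (a + b) → ℤ) →
  Σℤ (a + b) f ≡ Σℤ a (λ i → f (i ↑ˡ b)) ℤ.+ Σℤ b (λ j → f (a ↑ʳ j))
Σℤ-++ zero    b f = sym (ℤₚ.+-identityˡ _)
Σℤ-++ (suc a) b f =
  trans (cong (λ s → f zero ℤ.+ s) (Σℤ-++ a b (λ i → f (suc i)))) (sym (ℤₚ.+-assoc (f zero) _ _))

Σℚ-zero : ∀ k {f : Fin k → ℚ} → (∀ i → f i ≡ 0ℚ) → Σℚ k f ≡ 0ℚ
Σℚ-zero zero    f≗0 = refl
Σℚ-zero (suc k) f≗0 = cong₂ ℚ._+_ (f≗0 zero) (Σℚ-zero k (λ i → f≗0 (suc i)))

Σℤ-zero : ∀ k {f : Fin k → ℤ} → (∀ i → f i ≡ + 0) → Σℤ k f ≡ + 0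
Σℤ-zero zero    f≗0 = refl
Σℤ-zero (suc k) f≗0 = cong₂ ℤ._+_ (f≗0 zero) (Σℤ-zero k (λ i → f≗0 (suc i)))

Σℚ-ι : ∀ k (f : Fin k → ℤ) → Σℚ k (λ i → ι (f i)) ≡ ι (Σℤ k f)
Σℚ-ι zero    f = refl
Σℚ-ι (suc k) f =
  trans (cong (ι (f zero) ℚ.+_) (Σℚ-ι k (λ i → f (suc i)))) (sym (ι-homo-+ (f zero) _))

*-distribˡ-Σℚ : ∀ k c (f : Fin k → ℚ) → Σℚ k (λ i → c ℚ.* f i) ≡ c ℚ.* Σℚ k f
*-distribˡ-Σℚ zero    c f = sym (ℚₚ.*-zeroʳ c)
*-distribˡ-Σℚ (suc k) c f =
  trans (cong (c ℚ.* f zero ℚ.+_) (*-distribˡ-Σℚ k c (λ i → f (suc i))))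
        (sym (ℚₚ.*-distribˡ-+ c (f zero) _))

Σℤ-const : ∀ k c → Σℤ k (λ _ → c) ≡ + k ℤ.* c
Σℤ-const zero    c = sym (ℤₚ.*-zeroˡ c)
Σℤ-const (suc k) c = begin
  c ℤ.+ Σℤ k (λ _ → c)         ≡⟨ cong (λ s → c ℤ.+ s) (Σℤ-const k c) ⟩
  c ℤ.+ + k ℤ.* c              ≡⟨ cong (ℤ._+ + k ℤ.* c) (sym (ℤₚ.*-identityˡ c)) ⟩
  + 1 ℤ.* c ℤ.+ + k ℤ.* c      ≡⟨ sym (ℤₚ.*-distribʳ-+ c (+ 1) (+ k)) ⟩
  + suc k ℤ.* c                ∎
  where open ≡-Reasoning

Σℚ-const-ι : ∀ k c → Σℚ k (λ _ → ι (+ c)) ≡ ι (+ (k ℕ.* c))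
Σℚ-const-ι k c =
  trans (Σℚ-ι k (λ _ → + c)) (cong ι (trans (Σℤ-const k (+ c)) (sym (ℤₚ.pos-* k c))))

Σℤ-mono-≤ : ∀ k {f g : Fin k → ℤ} → (∀ i → f i ℤ.≤ g i) → Σℤ k f ℤ.≤ Σℤ k g
Σℤ-mono-≤ zero    f≤g = ℤₚ.≤-refl
Σℤ-mono-≤ (suc k) f≤g = ℤₚ.+-mono-≤ (f≤g zero) (Σℤ-mono-≤ k (λ i → f≤g (suc i)))

++-elim : ∀ {a b} (Q : Fin (a + b) → Set) →
  (∀ i → Q (i ↑ˡ b)) → (∀ j → Q (a ↑ʳ j)) → ∀ r → Q r
++-elim {a} {b} Q qˡ qʳ r = subst Q (Finₚ.join-splitAt a b r) (onSplit (splitAt a r))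
  where
  onSplit : (s : Fin a ⊎ Fin b) → Q (join a b s)
  onSplit (inj₁ i) = qˡ i
  onSplit (inj₂ j) = qʳ j

++-all : ∀ {a b} {A : Set} (Q : A → Set) {f : Fin a → A} {g : Fin b → A} →
  (∀ i → Q (f i)) → (∀ j → Q (g j)) → ∀ r → Q ((f ++ g) r)
++-all {a} Q qf qg r with splitAt a r
... | inj₁ i = qf i
... | inj₂ j = qg j

++-column : ∀ {a b} {A B : Set} (f : Fin a → A → B) (g : Fin b → A → B) r x →
  (f ++ g) r x ≡ ((λ i → f i x) ++ (λ j → g j x)) r
++-column {a} f g r x with splitAt a r
... | inj₁ i = refl
... | inj₂ j = refl

infix 7 _·_

_·_ : ∀ {c} → (Fin c → ℤ) → (Fin c → ℚ) → ℚ
_·_ {c} A P = Σℚ c (λ j → ι (A j) ℚ.* P j)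

∥_∥₁ : ∀ {r} → (Fin r → ℤ) → ℤ
∥_∥₁ {r} A = Σℤ r (λ i → + ℤ.∣ A i ∣)

·-congˡ : ∀ {c} {A B : Fin c → ℤ} (P : Fin c → ℚ) → (∀ j → A j ≡ B j) → A · P ≡ B · P
·-congˡ {c} P A≗B = Σℚ-cong c (λ j → cong (λ x → ι x ℚ.* P j) (A≗B j))

·-congʳ : ∀ {c} (A : Fin c → ℤ) {P R : Fin c → ℚ} → (∀ j → P j ≡ R j) → A · P ≡ A · R
·-congʳ {c} A P≗R = Σℚ-cong c (λ j → cong (ι (A j) ℚ.*_) (P≗R j))

∥∥₁-cong : ∀ {r} {A B : Fin r → ℤ} → (∀ i → A i ≡ B i) → ∥ A ∥₁ ≡ ∥ B ∥₁
∥∥₁-cong {r} A≗B = Σℤ-cong r (λ i → cong (λ x → + ℤ.∣ x ∣) (A≗B i))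

zeros : ∀ {c} → Fin c → ℤ
zeros _ = + 0

ones : ∀ {c} → Fin c → ℤ
ones _ = + 1

zeros-· : ∀ {c} (P : Fin c → ℚ) → zeros · P ≡ 0ℚ
zeros-· {c} P = Σℚ-zero c (λ j → ℚₚ.*-zeroˡ (P j))

∥zeros∥₁ : ∀ r → ∥ zeros {r} ∥₁ ≡ + 0
∥zeros∥₁ r = Σℤ-zero r (λ _ → refl)

const-· : ∀ {c} x (P : Fin c → ℚ) → (λ _ → x) · P ≡ ι x ℚ.* Σℚ c P
const-· {c} x P = *-distribˡ-Σℚ c (ι x) P

ones-· : ∀ {c} (P : Fin c → ℚ) → ones · P ≡ Σℚ c P
ones-· {c} P = trans (const-· (+ 1) P) (ℚₚ.*-identityˡ (Σℚ c P))

·-++ : ∀ {a b} (A : Fin a → ℤ) (B : Fin b → ℤ) (P : Fin (a + b) → ℚ) →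
  (A ++ B) · P ≡ A · (λ i → P (i ↑ˡ b)) ℚ.+ B · (λ j → P (a ↑ʳ j))
·-++ {a} {b} A B P = trans (Σℚ-++ a b _) (cong₂ ℚ._+_
  (Σℚ-cong a (λ i → cong (λ x → ι x ℚ.* P (i ↑ˡ b)) (lookup-++ˡ A B i)))
  (Σℚ-cong b (λ j → cong (λ x → ι x ℚ.* P (a ↑ʳ j)) (lookup-++ʳ A B j))))

zero∷-· : ∀ {c} (A : Fin c → ℤ) (P : Fin (suc c) → ℚ) → (+ 0 ∷ A) · P ≡ A · (λ j → P (suc j))
zero∷-· A P = trans (cong (ℚ._+ A · (λ j → P (suc j))) (ℚₚ.*-zeroˡ (P zero))) (ℚₚ.+-identityˡ _)

∷zeros-· : ∀ {c} x (P : Fin (suc c) → ℚ) → (x ∷ zeros) · P ≡ ι x ℚ.* P zero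
∷zeros-· x P = trans (cong (ι x ℚ.* P zero ℚ.+_) (zeros-· (λ j → P (suc j)))) (ℚₚ.+-identityʳ _)

zeros++-· : ∀ {a b} (A : Fin b → ℤ) (P : Fin (a + b) → ℚ) → (zeros ++ A) · P ≡ A · (λ j → P (a ↑ʳ j))
zeros++-· {a} {b} A P = begin
  (zeros ++ A) · P
    ≡⟨ ·-++ zeros A P ⟩
  zeros {a} · (λ i → P (i ↑ˡ b)) ℚ.+ A · (λ j → P (a ↑ʳ j))
    ≡⟨ cong (ℚ._+ A · (λ j → P (a ↑ʳ j))) (zeros-· (λ i → P (i ↑ˡ b))) ⟩
  0ℚ ℚ.+ A · (λ j → P (a ↑ʳ j))
    ≡⟨ ℚₚ.+-identityˡ _ ⟩
  A · (λ j → P (a ↑ʳ j)) ∎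
  where open ≡-Reasoning

∥++∥₁ : ∀ {a b} (A : Fin a → ℤ) (B : Fin b → ℤ) → ∥ A ++ B ∥₁ ≡ ∥ A ∥₁ ℤ.+ ∥ B ∥₁
∥++∥₁ {a} {b} A B = trans (Σℤ-++ a b _) (cong₂ ℤ._+_
  (∥∥₁-cong (lookup-++ˡ A B))
  (∥∥₁-cong (lookup-++ʳ A B)))

indicator : ∀ {a} → Fin a → Fin a → ℤ
indicator zero    zero    = + 1
indicator zero    (suc j) = + 0
indicator (suc i) zero    = + 0
indicator (suc i) (suc j) = indicator i j

indicator-· : ∀ {a} (i : Fin a) (P : Fin a → ℚ) → indicator i · P ≡ P i
indicator-· {suc a} zero P = begin
  ι (+ 1) ℚ.* P zero ℚ.+ zeros {a} · (λ j → P (suc j))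
    ≡⟨ cong₂ ℚ._+_ (ℚₚ.*-identityˡ (P zero)) (zeros-· (λ j → P (suc j))) ⟩
  P zero ℚ.+ 0ℚ
    ≡⟨ ℚₚ.+-identityʳ (P zero) ⟩
  P zero ∎
  where open ≡-Reasoning
indicator-· {suc a} (suc i) P = begin
  ι (+ 0) ℚ.* P zero ℚ.+ indicator i · (λ j → P (suc j))
    ≡⟨ cong₂ ℚ._+_ (ℚₚ.*-zeroˡ (P zero)) (indicator-· i (λ j → P (suc j))) ⟩
  0ℚ ℚ.+ P (suc i)
    ≡⟨ ℚₚ.+-identityˡ (P (suc i)) ⟩
  P (suc i) ∎
  where open ≡-Reasoning

∥indicator-column∥₁ : ∀ {a} (j : Fin a) → ∥ (λ i → indicator i j) ∥₁ ≡ + 1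
∥indicator-column∥₁ {suc a} zero    = cong (λ s → + 1 ℤ.+ s) (∥zeros∥₁ a)
∥indicator-column∥₁ {suc a} (suc j) = trans (ℤₚ.+-identityˡ _) (∥indicator-column∥₁ j)

indicator-diagonal : ∀ {a} (i : Fin a) → indicator i i ≡ + 1
indicator-diagonal zero    = refl
indicator-diagonal (suc i) = indicator-diagonal i

indicator-off-diagonal : ∀ {a} (i j : Fin a) → i ≢ j → indicator i j ≡ + 0
indicator-off-diagonal zero    zero    i≢j = ⊥-elim (i≢j refl)
indicator-off-diagonal zero    (suc j) i≢j = refl
indicator-off-diagonal (suc i) zero    i≢j = refl
indicator-off-diagonal (suc i) (suc j) i≢j = indicator-off-diagonal i j (λ eq → i≢j (cong suc eq))

indicator-elim : ∀ {a} (Q : ℤ → Set) → Q (+ 0) → Q (+ 1) → (i j : Fin a) → Q (indicator i j)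
indicator-elim Q q₀ q₁ zero    zero    = q₁
indicator-elim Q q₀ q₁ zero    (suc j) = q₀
indicator-elim Q q₀ q₁ (suc i) zero    = q₀
indicator-elim Q q₀ q₁ (suc i) (suc j) = indicator-elim Q q₀ q₁ i j

indicator-inject₁-column : ∀ {a} (j : Fin (suc a)) → ∥ (λ (i : Fin a) → indicator (Fin.inject₁ i) j) ∥₁ ℤ.≤ + 1
indicator-inject₁-column {zero}  j       = ℤ.+≤+ ℕ.z≤n
indicator-inject₁-column {suc a} zero    = ℤₚ.≤-reflexive (cong (λ s → + 1 ℤ.+ s) (Σℤ-zero a (λ _ → refl)))
indicator-inject₁-column {suc a} (suc j) = ℤₚ.≤-trans (ℤₚ.≤-reflexive (ℤₚ.+-identityˡ _)) (indicator-inject₁-column j)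

-- Block upper triangular matrices  [ NN NO ; 0 OO ]

module _ {a b c d : ℕ}
  (NN : Fin a → Fin c → ℤ) (NO : Fin a → Fin d → ℤ) (OO : Fin b → Fin d → ℤ) where

  private
    upperRows : Fin a → Fin (c + d) → ℤ
    upperRows i = NN i ++ NO i
    lowerRows : Fin b → Fin (c + d) → ℤ
    lowerRows i = zeros ++ OO i

  blockUpper : Fin (a + b) → Fin (c + d) → ℤ
  blockUpper = upperRows ++ lowerRows

  blockUpper-upperRow : ∀ i (P : Fin (c + d) → ℚ) →
    blockUpper (i ↑ˡ b) · P ≡ NN i · (λ j → P (j ↑ˡ d)) ℚ.+ NO i · (λ j → P (c ↑ʳ j))
  blockUpper-upperRow i P =
    trans (·-congˡ P (λ v → cong (λ A → A v) (lookup-++ˡ upperRows lowerRows i))) (·-++ (NN i) (NO i) P)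

  blockUpper-lowerRow : ∀ i (P : Fin (c + d) → ℚ) →
    blockUpper (a ↑ʳ i) · P ≡ OO i · (λ j → P (c ↑ʳ j))
  blockUpper-lowerRow i P =
    trans (·-congˡ P (λ v → cong (λ A → A v) (lookup-++ʳ upperRows lowerRows i))) (zeros++-· (OO i) P)

  blockUpper-leftColumn : ∀ j → ∥ (λ r → blockUpper r (j ↑ˡ d)) ∥₁ ≡ ∥ (λ i → NN i j) ∥₁
  blockUpper-leftColumn j = begin
    ∥ (λ r → blockUpper r (j ↑ˡ d)) ∥₁
      ≡⟨ ∥∥₁-cong (λ r → ++-column upperRows lowerRows r (j ↑ˡ d)) ⟩
    ∥ (λ i → (NN i ++ NO i) (j ↑ˡ d)) ++ (λ i → (zeros ++ OO i) (j ↑ˡ d)) ∥₁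
      ≡⟨ ∥++∥₁ (λ i → (NN i ++ NO i) (j ↑ˡ d)) (λ i → (zeros ++ OO i) (j ↑ˡ d)) ⟩
    ∥ (λ i → (NN i ++ NO i) (j ↑ˡ d)) ∥₁ ℤ.+ ∥ (λ i → (zeros ++ OO i) (j ↑ˡ d)) ∥₁
      ≡⟨ cong₂ ℤ._+_ (∥∥₁-cong (λ i → lookup-++ˡ (NN i) (NO i) j))
                      (trans (∥∥₁-cong (λ i → lookup-++ˡ (zeros {c}) (OO i) j)) (∥zeros∥₁ b)) ⟩
    ∥ (λ i → NN i j) ∥₁ ℤ.+ + 0
      ≡⟨ ℤₚ.+-identityʳ _ ⟩
    ∥ (λ i → NN i j) ∥₁ ∎
    where open ≡-Reasoning

  blockUpper-rightColumn : ∀ j →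
    ∥ (λ r → blockUpper r (c ↑ʳ j)) ∥₁ ≡ ∥ (λ i → NO i j) ∥₁ ℤ.+ ∥ (λ i → OO i j) ∥₁
  blockUpper-rightColumn j = begin
    ∥ (λ r → blockUpper r (c ↑ʳ j)) ∥₁
      ≡⟨ ∥∥₁-cong (λ r → ++-column upperRows lowerRows r (c ↑ʳ j)) ⟩
    ∥ (λ i → (NN i ++ NO i) (c ↑ʳ j)) ++ (λ i → (zeros ++ OO i) (c ↑ʳ j)) ∥₁
      ≡⟨ ∥++∥₁ (λ i → (NN i ++ NO i) (c ↑ʳ j)) (λ i → (zeros ++ OO i) (c ↑ʳ j)) ⟩
    ∥ (λ i → (NN i ++ NO i) (c ↑ʳ j)) ∥₁ ℤ.+ ∥ (λ i → (zeros ++ OO i) (c ↑ʳ j)) ∥₁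
      ≡⟨ cong₂ ℤ._+_ (∥∥₁-cong (λ i → lookup-++ʳ (NN i) (NO i) j))
                      (∥∥₁-cong (λ i → lookup-++ʳ (zeros {c}) (OO i) j)) ⟩
    ∥ (λ i → NO i j) ∥₁ ℤ.+ ∥ (λ i → OO i j) ∥₁ ∎
    where open ≡-Reasoning

  blockUpper-all : (Q : ℤ → Set) → Q (+ 0) →
    (∀ i j → Q (NN i j)) → (∀ i j → Q (NO i j)) → (∀ i j → Q (OO i j)) →
    ∀ r v → Q (blockUpper r v)
  blockUpper-all Q q₀ qNN qNO qOO =
    ++-all (λ A → ∀ v → Q (A v)) {f = upperRows} {g = lowerRows}
      (λ i → ++-all Q (qNN i) (qNO i)) (λ i → ++-all Q {f = zeros} (λ _ → q₀) (qOO i))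

rightSummand-unique : ∀ {a b a' b' r : ℚ} → a ℚ.+ b ≡ r → a' ℚ.+ b' ≡ r → a ≡ a' → b ≡ b'
rightSummand-unique {a} e e' refl = ∙-cancelˡ a _ _ (trans e (sym e'))

leftSummand-unique : ∀ {a b a' b' r : ℚ} → a ℚ.+ b ≡ r → a' ℚ.+ b' ≡ r → b ≡ b' → a ≡ a'
leftSummand-unique {b = b} e e' refl = ∙-cancelʳ b _ _ (trans e (sym e'))

double-injective : ∀ {x y} → x ℚ.+ x ≡ y ℚ.+ y → x ≡ y
double-injective {x} {y} eq = begin
  x                   ≡⟨ sym (halve x) ⟩
  half ℚ.* (x ℚ.+ x)  ≡⟨ cong (half ℚ.*_) eq ⟩
  half ℚ.* (y ℚ.+ y)  ≡⟨ halve y ⟩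
  y                   ∎
  where
  open ≡-Reasoning
  halve : ∀ z → half ℚ.* (z ℚ.+ z) ≡ z
  halve z = begin
    half ℚ.* (z ℚ.+ z)           ≡⟨ ℚₚ.*-distribˡ-+ half z z ⟩
    half ℚ.* z ℚ.+ half ℚ.* z    ≡⟨ sym (ℚₚ.*-distribʳ-+ z half half) ⟩
    (half ℚ.+ half) ℚ.* z        ≡⟨ ℚₚ.*-identityˡ z ⟩
    z                            ∎

nonNegative-midpoint-zero : ∀ {x y} → 0ℚ ℚ.≤ x → 0ℚ ℚ.≤ y → 0ℚ ≡ half ℚ.* (x ℚ.+ y) → x ≡ 0ℚ
nonNegative-midpoint-zero {x} {y} 0≤x 0≤y mid = ℚₚ.≤-antisym x≤0 0≤x
  where
  open ≡-Reasoning
  x+y≡0 : x ℚ.+ y ≡ 0ℚ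
  x+y≡0 = begin
    x ℚ.+ y                        ≡⟨ sym (ℚₚ.*-identityˡ _) ⟩
    (ι (+ 2) ℚ.* half) ℚ.* (x ℚ.+ y) ≡⟨ ℚₚ.*-assoc (ι (+ 2)) half (x ℚ.+ y) ⟩
    ι (+ 2) ℚ.* (half ℚ.* (x ℚ.+ y)) ≡⟨ cong (ι (+ 2) ℚ.*_) (sym mid) ⟩
    ι (+ 2) ℚ.* 0ℚ                 ≡⟨ ℚₚ.*-zeroʳ (ι (+ 2)) ⟩
    0ℚ                             ∎
  x≤0 : x ℚ.≤ 0ℚ
  x≤0 = subst₂ ℚ._≤_ (ℚₚ.+-identityʳ x) x+y≡0 (ℚₚ.+-monoʳ-≤ x 0≤y)

nonNegative-summand-zero : ∀ {s S K} → s ℤ.+ S ≡ K → K ℤ.≤ S → + 0 ℤ.≤ s → s ≡ + 0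
nonNegative-summand-zero {s} {S} {K} eq K≤S 0≤s =
  ℤₚ.≤-antisym (subst (ℤ._≤ + 0) (sym (x≈z//y s S K eq)) (ℤₚ.i≤j⇒i-j≤0 K≤S)) 0≤s

1≤f-of-2a+f≡1 : ∀ {a f} → + 0 ℤ.≤ a → + 0 ℤ.≤ f → a ℤ.+ (a ℤ.+ f) ≡ + 1 → + 1 ℤ.≤ f
1≤f-of-2a+f≡1 {+ zero}  {+ f} _ _ eq = ℤₚ.≤-reflexive (sym eq)
1≤f-of-2a+f≡1 {+ suc a} {+ f} _ _ eq =
  ⊥-elim (ℕₚ.m+1+n≢0 a (ℕₚ.suc-injective (ℤₚ.+-injective eq)))

TM-row : ∀ {p h m n} → Instance p h m n → Fin m → Point p n → ℚ
TM-row I r P = T I r · proj₁ P ℚ.+ M I r · proj₂ P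

CW-row : ∀ {p h m n} → Instance p h m n → Fin h → Point p n → ℚ
CW-row I r P = C I r · proj₁ P ℚ.+ W I r · proj₂ P

LPFeasible-cong : ∀ {p h m n} (I : Instance p h m n) {P R : Point p n} →
  (∀ j → proj₁ P j ≡ proj₁ R j) → (∀ i → proj₂ P i ≡ proj₂ R i) → LPFeasible I P → LPFeasible I R
LPFeasible-cong I {P} {R} y≗ x≗ (lpFeasible eqCW eqTM lowY uppY lowX uppX) = lpFeasible
  (λ i → trans (sym (cong₂ ℚ._+_ (·-congʳ (C I i) y≗) (·-congʳ (W I i) x≗))) (eqCW i))
  (λ i → trans (sym (cong₂ ℚ._+_ (·-congʳ (T I i) y≗) (·-congʳ (M I i) x≗))) (eqTM i))
  (λ j → subst (ι (e I j) ℚ.≤_) (y≗ j) (lowY j))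
  (λ j → subst (ℚ._≤ ι (g I j)) (y≗ j) (uppY j))
  (λ i → subst (ι (l I i) ℚ.≤_) (x≗ i) (lowX i))
  (λ i v u≡v → subst (ℚ._≤ ι v) (x≗ i) (uppX i v u≡v))

module _ {p h m n : ℕ} (I : Instance p h m n) (bounds : ZeroLowerNoUpper I) where

  nonNegative⇒lowX : ∀ {x : Fin n → ℚ} → (∀ i → 0ℚ ℚ.≤ x i) → ∀ i → ι (l I i) ℚ.≤ x i
  nonNegative⇒lowX {x} 0≤x i = subst (λ z → ι z ℚ.≤ x i) (sym (proj₁ bounds i)) (0≤x i)

  lowX⇒nonNegative : ∀ {x : Fin n → ℚ} → (∀ i → ι (l I i) ℚ.≤ x i) → ∀ i → 0ℚ ℚ.≤ x i
  lowX⇒nonNegative {x} lowX i = subst (λ z → ι z ℚ.≤ x i) (proj₁ bounds i) (lowX i)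

  noUpperBound : ∀ {x : Fin n → ℚ} i v → u I i ≡ just v → x i ℚ.≤ ι v
  noUpperBound i v u≡v with trans (sym (proj₂ bounds i)) u≡v
  ... | ()

zero∈01Δ : ∀ {Δ} → In01Δ Δ (+ 0)
zero∈01Δ = inj₁ refl

one∈01Δ : ∀ {Δ} → In01Δ Δ (+ 1)
one∈01Δ = inj₂ (inj₁ refl)

Δ∈01Δ : ∀ {Δ} → In01Δ Δ (+ Δ)
Δ∈01Δ = inj₂ (inj₂ refl)

indicator∈01Δ : ∀ {Δ a} (i j : Fin a) → In01Δ Δ (indicator i j)
indicator∈01Δ = indicator-elim (In01Δ _) zero∈01Δ one∈01Δ

-- The pivot column has 1-norm at most 1, so the next construction can tie
-- the pivot variable to one new row without breaking the column bound.
record HardInstance (Δ p h m n : ℕ) : Set where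
  field
    problem         : Instance p h m n
    pivot           : Fin n
    gap             : ℕ
    vertex          : Point p n
    witness         : IntPoint p n
    columns≤2       : MColumnsNorm≤2 problem
    pivotColumn≤1   : ∥ (λ r → M problem r pivot) ∥₁ ℤ.≤ + 1
    standardBounds  : ZeroLowerNoUpper problem
    coefficients    : CoeffsIn01Δ Δ problem
    isVertex        : IsLPVertex problem vertex
    witnessFeasible : IntFeasible problem witness
    vertex-pivot    : proj₂ vertex pivot ≡ ι (+ gap)
    integral-pivot  : ∀ w → IntFeasible problem w → proj₂ w pivot ≡ + 0

module Tie {Δ p h m n : ℕ} (B : HardInstance Δ p h m n) where
  open HardInstance B

  tieRows : ∀ {r} → Fin (suc r) → Fin n → ℤ
  tieRows = indicator pivot ∷ (λ _ → zeros)

  extendM : ∀ {r c} → (Fin (suc r) → Fin c → ℤ) → Fin (suc r + m) → Fin (c + n) → ℤ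
  extendM newM = blockUpper newM tieRows (M problem)

  tieRows-column : ∀ {r} i → ∥ (λ t → tieRows {r} t i) ∥₁ ≡ + ℤ.∣ indicator pivot i ∣
  tieRows-column {r} i =
    trans (cong (λ s → + ℤ.∣ indicator pivot i ∣ ℤ.+ s) (∥zeros∥₁ r)) (ℤₚ.+-identityʳ _)

  tiedColumn≤2 : ∀ {r} i → ∥ (λ t → tieRows {r} t i) ∥₁ ℤ.+ ∥ (λ t → M problem t i) ∥₁ ℤ.≤ + 2
  tiedColumn≤2 {r} i with i Fin.≟ pivot
  ... | yes refl = ℤₚ.≤-trans
    (ℤₚ.≤-reflexive (cong (ℤ._+ ∥ (λ t → M problem t pivot) ∥₁)
      (trans (tieRows-column {r} pivot) (cong (λ z → + ℤ.∣ z ∣) (indicator-diagonal pivot)))))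
    (ℤₚ.+-monoʳ-≤ (+ 1) pivotColumn≤1)
  ... | no i≢pivot = ℤₚ.≤-trans
    (ℤₚ.≤-reflexive (trans (cong (ℤ._+ ∥ (λ t → M problem t i) ∥₁)
      (trans (tieRows-column {r} i)
             (cong (λ z → + ℤ.∣ z ∣) (indicator-off-diagonal pivot i (λ eq → i≢pivot (sym eq))))))
      (ℤₚ.+-identityˡ _)))
    (columns≤2 i)

  tieRows∈01Δ : ∀ {r} t j → In01Δ Δ (tieRows {r} t j)
  tieRows∈01Δ zero    j = indicator∈01Δ pivot j
  tieRows∈01Δ (suc t) j = zero∈01Δ

  extendM-columns≤2 : ∀ {r c} (newM : Fin (suc r) → Fin c → ℤ) →
    (∀ j → ∥ (λ i → newM i j) ∥₁ ℤ.≤ + 2) → ∀ v → ∥ (λ t → extendM newM t v) ∥₁ ℤ.≤ + 2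
  extendM-columns≤2 {r} newM new≤2 = ++-elim _
    (λ j → ℤₚ.≤-trans (ℤₚ.≤-reflexive (blockUpper-leftColumn newM tieRows (M problem) j)) (new≤2 j))
    (λ i → ℤₚ.≤-trans (ℤₚ.≤-reflexive (blockUpper-rightColumn newM tieRows (M problem) i)) (tiedColumn≤2 {r} i))

  extendM-∈01Δ : ∀ {r c} (newM : Fin (suc r) → Fin c → ℤ) →
    (∀ i j → In01Δ Δ (newM i j)) → ∀ t v → In01Δ Δ (extendM newM t v)
  extendM-∈01Δ newM new∈ = blockUpper-all newM tieRows (M problem) (In01Δ Δ) zero∈01Δ new∈
    tieRows∈01Δ (proj₂ (proj₂ (proj₂ coefficients)))

  extendM-newRow : ∀ {r c} (newM : Fin (suc r) → Fin c → ℤ) i (x : Fin (c + n) → ℚ) →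
    extendM newM (i ↑ˡ m) · x ≡ newM i · (λ j → x (j ↑ˡ n)) ℚ.+ tieRows i · (λ j → x (c ↑ʳ j))
  extendM-newRow newM = blockUpper-upperRow newM tieRows (M problem)

  extendM-oldRow : ∀ {r c} (newM : Fin (suc r) → Fin c → ℤ) i (x : Fin (c + n) → ℚ) →
    extendM newM (suc r ↑ʳ i) · x ≡ M problem i · (λ j → x (c ↑ʳ j))
  extendM-oldRow newM = blockUpper-lowerRow newM tieRows (M problem)

-- The base instance: k disjoint copies of the odd cycle  a + c + f = 1, a + b = 1,
-- b + c = 1, joined by the hub row  s + Σⱼ fⱼ = k.  The LP vertex has a = b = c = ½,
-- f = 0, s = k; integrally a = c and 2a + f = 1 force f = 1, hence s = 0.

module BaseInstance (Δ k : ℕ) where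

  n₀ m₀ : ℕ
  n₀ = suc (k + (k + (k + k)))
  m₀ = suc (k + (k + k))

  layout : {X : Set} → X → (A B C F : Fin k → X) → Fin n₀ → X
  layout x₀ A B C F = x₀ ∷ (A ++ (B ++ (C ++ F)))

  aVar bVar cVar fVar : Fin k → Fin n₀
  aVar j = suc (j ↑ˡ (k + (k + k)))
  bVar j = suc (k ↑ʳ (j ↑ˡ (k + k)))
  cVar j = suc (k ↑ʳ (k ↑ʳ (j ↑ˡ k)))
  fVar j = suc (k ↑ʳ (k ↑ʳ (k ↑ʳ j)))

  module Layout {X : Set} (x₀ : X) (A B C F : Fin k → X) where

    lookup-a : ∀ j → layout x₀ A B C F (aVar j) ≡ A j
    lookup-a = lookup-++ˡ A (B ++ (C ++ F))

    lookup-b : ∀ j → layout x₀ A B C F (bVar j) ≡ B j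
    lookup-b j = trans (lookup-++ʳ A (B ++ (C ++ F)) (j ↑ˡ (k + k))) (lookup-++ˡ B (C ++ F) j)

    lookup-c : ∀ j → layout x₀ A B C F (cVar j) ≡ C j
    lookup-c j = trans (lookup-++ʳ A (B ++ (C ++ F)) (k ↑ʳ (j ↑ˡ k)))
                       (trans (lookup-++ʳ B (C ++ F) (j ↑ˡ k)) (lookup-++ˡ C F j))

    lookup-f : ∀ j → layout x₀ A B C F (fVar j) ≡ F j
    lookup-f j = trans (lookup-++ʳ A (B ++ (C ++ F)) (k ↑ʳ (k ↑ʳ j)))
                       (trans (lookup-++ʳ B (C ++ F) (k ↑ʳ j)) (lookup-++ʳ C F j))

  layout-elim : (Q : Fin n₀ → Set) → Q zero →
    (∀ j → Q (aVar j)) → (∀ j → Q (bVar j)) → (∀ j → Q (cVar j)) → (∀ j → Q (fVar j)) → ∀ v → Q v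
  layout-elim Q q₀ qa qb qc qf zero    = q₀
  layout-elim Q q₀ qa qb qc qf (suc v) =
    ++-elim (λ v → Q (suc v)) qa (++-elim (λ v → Q (suc (k ↑ʳ v))) qb
      (++-elim (λ v → Q (suc (k ↑ʳ (k ↑ʳ v)))) qc qf)) v

  layout-all : {X : Set} (Q : X → Set) {x₀ : X} {A B C F : Fin k → X} → Q x₀ →
    (∀ j → Q (A j)) → (∀ j → Q (B j)) → (∀ j → Q (C j)) → (∀ j → Q (F j)) →
    ∀ v → Q (layout x₀ A B C F v)
  layout-all Q {x₀} {A} {B} {C} {F} q₀ qa qb qc qf = layout-elim _ q₀
    (λ j → subst Q (sym (Layout.lookup-a x₀ A B C F j)) (qa j))
    (λ j → subst Q (sym (Layout.lookup-b x₀ A B C F j)) (qb j))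
    (λ j → subst Q (sym (Layout.lookup-c x₀ A B C F j)) (qc j))
    (λ j → subst Q (sym (Layout.lookup-f x₀ A B C F j)) (qf j))

  layout-· : ∀ s₀ (A B C F : Fin k → ℤ) (x : Fin n₀ → ℚ) → layout s₀ A B C F · x ≡
    ι s₀ ℚ.* x zero ℚ.+
      (A · (λ j → x (aVar j)) ℚ.+ (B · (λ j → x (bVar j)) ℚ.+ (C · (λ j → x (cVar j)) ℚ.+ F · (λ j → x (fVar j)))))
  layout-· s₀ A B C F x = cong (ι s₀ ℚ.* x zero ℚ.+_)
    (trans (·-++ A (B ++ (C ++ F)) _) (cong (A · (λ j → x (aVar j)) ℚ.+_)
      (trans (·-++ B (C ++ F) _) (cong (B · (λ j → x (bVar j)) ℚ.+_) (·-++ C F _)))))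

  hubRow : Fin n₀ → ℤ
  hubRow = layout (+ 1) zeros zeros zeros ones

  rowA rowB rowC : Fin k → Fin n₀ → ℤ
  rowA j = layout (+ 0) (indicator j) zeros (indicator j) (indicator j)
  rowB j = layout (+ 0) (indicator j) (indicator j) zeros zeros
  rowC j = layout (+ 0) zeros (indicator j) (indicator j) zeros

  module Hub = Layout (+ 1) zeros zeros zeros ones
  module RowA (j : Fin k) = Layout (+ 0) (indicator j) zeros (indicator j) (indicator j)
  module RowB (j : Fin k) = Layout (+ 0) (indicator j) (indicator j) zeros zeros
  module RowC (j : Fin k) = Layout (+ 0) zeros (indicator j) (indicator j) zeros

  M₀ : Fin m₀ → Fin n₀ → ℤ
  M₀ = hubRow ∷ (rowA ++ (rowB ++ rowC))

  problem : Instance 0 0 m₀ n₀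
  problem = record
    { a = λ () ; c = zeros
    ; C = λ () ; W = λ () ; T = λ _ () ; M = M₀
    ; d = λ () ; b = + k ∷ (λ _ → + 1)
    ; e = λ () ; g = λ ()
    ; l = zeros ; u = λ _ → nothing }

  rowAVar rowBVar rowCVar : Fin k → Fin m₀
  rowAVar j = suc (j ↑ˡ (k + k))
  rowBVar j = suc (k ↑ʳ (j ↑ˡ k))
  rowCVar j = suc (k ↑ʳ (k ↑ʳ j))

  module _ (P : Point 0 n₀) where
    private
      x : Fin n₀ → ℚ
      x = proj₂ P
      s : ℚ
      s = x zero
      xa xb xc xf : Fin k → ℚ
      xa j = x (aVar j)
      xb j = x (bVar j)
      xc j = x (cVar j)
      xf j = x (fVar j)

    M₀-row : ∀ r → TM-row problem r P ≡ M₀ r · x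
    M₀-row r = ℚₚ.+-identityˡ (M₀ r · x)

    hubRowValue : TM-row problem zero P ≡ s ℚ.+ Σℚ k xf
    hubRowValue = begin
      TM-row problem zero P
        ≡⟨ trans (M₀-row zero) (layout-· (+ 1) zeros zeros zeros ones x) ⟩
      ι (+ 1) ℚ.* s ℚ.+ (zeros · xa ℚ.+ (zeros · xb ℚ.+ (zeros · xc ℚ.+ ones · xf)))
        ≡⟨ cong₂ ℚ._+_ (ℚₚ.*-identityˡ s)
             (cong₂ ℚ._+_ (zeros-· xa) (cong₂ ℚ._+_ (zeros-· xb) (cong₂ ℚ._+_ (zeros-· xc) (ones-· xf)))) ⟩
      s ℚ.+ (0ℚ ℚ.+ (0ℚ ℚ.+ (0ℚ ℚ.+ Σℚ k xf)))
        ≡⟨ cong (s ℚ.+_) (trans (ℚₚ.+-identityˡ _) (trans (ℚₚ.+-identityˡ _) (ℚₚ.+-identityˡ _))) ⟩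
      s ℚ.+ Σℚ k xf ∎
      where open ≡-Reasoning

    rowAValue : ∀ j → TM-row problem (rowAVar j) P ≡ xa j ℚ.+ (xc j ℚ.+ xf j)
    rowAValue j = begin
      TM-row problem (rowAVar j) P
        ≡⟨ trans (M₀-row (rowAVar j)) (·-congˡ x (λ v → cong (λ R → R v) (lookup-++ˡ rowA (rowB ++ rowC) j))) ⟩
      rowA j · x
        ≡⟨ layout-· (+ 0) (indicator j) zeros (indicator j) (indicator j) x ⟩
      ι (+ 0) ℚ.* s ℚ.+ (indicator j · xa ℚ.+ (zeros · xb ℚ.+ (indicator j · xc ℚ.+ indicator j · xf)))
        ≡⟨ cong₂ ℚ._+_ (ℚₚ.*-zeroˡ s) (cong₂ ℚ._+_ (indicator-· j xa)
             (cong₂ ℚ._+_ (zeros-· xb) (cong₂ ℚ._+_ (indicator-· j xc) (indicator-· j xf)))) ⟩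
      0ℚ ℚ.+ (xa j ℚ.+ (0ℚ ℚ.+ (xc j ℚ.+ xf j)))
        ≡⟨ trans (ℚₚ.+-identityˡ _) (cong (xa j ℚ.+_) (ℚₚ.+-identityˡ _)) ⟩
      xa j ℚ.+ (xc j ℚ.+ xf j) ∎
      where open ≡-Reasoning

    rowBValue : ∀ j → TM-row problem (rowBVar j) P ≡ xa j ℚ.+ xb j
    rowBValue j = begin
      TM-row problem (rowBVar j) P
        ≡⟨ trans (M₀-row (rowBVar j)) (·-congˡ x (λ v → cong (λ R → R v)
             (trans (lookup-++ʳ rowA (rowB ++ rowC) (j ↑ˡ k)) (lookup-++ˡ rowB rowC j)))) ⟩
      rowB j · x
        ≡⟨ layout-· (+ 0) (indicator j) (indicator j) zeros zeros x ⟩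
      ι (+ 0) ℚ.* s ℚ.+ (indicator j · xa ℚ.+ (indicator j · xb ℚ.+ (zeros · xc ℚ.+ zeros · xf)))
        ≡⟨ cong₂ ℚ._+_ (ℚₚ.*-zeroˡ s) (cong₂ ℚ._+_ (indicator-· j xa)
             (cong₂ ℚ._+_ (indicator-· j xb) (cong₂ ℚ._+_ (zeros-· xc) (zeros-· xf)))) ⟩
      0ℚ ℚ.+ (xa j ℚ.+ (xb j ℚ.+ (0ℚ ℚ.+ 0ℚ)))
        ≡⟨ trans (ℚₚ.+-identityˡ _) (cong (xa j ℚ.+_) (ℚₚ.+-identityʳ (xb j))) ⟩
      xa j ℚ.+ xb j ∎
      where open ≡-Reasoning

    rowCValue : ∀ j → TM-row problem (rowCVar j) P ≡ xb j ℚ.+ xc j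
    rowCValue j = begin
      TM-row problem (rowCVar j) P
        ≡⟨ trans (M₀-row (rowCVar j)) (·-congˡ x (λ v → cong (λ R → R v)
             (trans (lookup-++ʳ rowA (rowB ++ rowC) (k ↑ʳ j)) (lookup-++ʳ rowB rowC j)))) ⟩
      rowC j · x
        ≡⟨ layout-· (+ 0) zeros (indicator j) (indicator j) zeros x ⟩
      ι (+ 0) ℚ.* s ℚ.+ (zeros · xa ℚ.+ (indicator j · xb ℚ.+ (indicator j · xc ℚ.+ zeros · xf)))
        ≡⟨ cong₂ ℚ._+_ (ℚₚ.*-zeroˡ s) (cong₂ ℚ._+_ (zeros-· xa)
             (cong₂ ℚ._+_ (indicator-· j xb) (cong₂ ℚ._+_ (indicator-· j xc) (zeros-· xf)))) ⟩
      0ℚ ℚ.+ (0ℚ ℚ.+ (xb j ℚ.+ (xc j ℚ.+ 0ℚ)))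
        ≡⟨ trans (ℚₚ.+-identityˡ _) (trans (ℚₚ.+-identityˡ _) (cong (xb j ℚ.+_) (ℚₚ.+-identityʳ (xc j)))) ⟩
      xb j ℚ.+ xc j ∎
      where open ≡-Reasoning

    record CycleEquations : Set where
      field
        hub  : s ℚ.+ Σℚ k xf ≡ ι (+ k)
        eqA  : ∀ j → xa j ℚ.+ (xc j ℚ.+ xf j) ≡ 1ℚ
        eqB  : ∀ j → xa j ℚ.+ xb j ≡ 1ℚ
        eqC  : ∀ j → xb j ℚ.+ xc j ≡ 1ℚ

      a≡c : ∀ j → xa j ≡ xc j
      a≡c j = leftSummand-unique (eqB j) (trans (ℚₚ.+-comm (xc j) (xb j)) (eqC j)) refl

      a+[a+f]≡1 : ∀ j → xa j ℚ.+ (xa j ℚ.+ xf j) ≡ 1ℚ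
      a+[a+f]≡1 j = trans (cong (λ z → xa j ℚ.+ (z ℚ.+ xf j)) (a≡c j)) (eqA j)

      a+a≡1 : ∀ j → xf j ≡ 0ℚ → xa j ℚ.+ xa j ≡ 1ℚ
      a+a≡1 j f≡0 =
        trans (cong (xa j ℚ.+_) (sym (trans (cong (xa j ℚ.+_) f≡0) (ℚₚ.+-identityʳ (xa j))))) (a+[a+f]≡1 j)

    feasible-intro : CycleEquations → (∀ i → 0ℚ ℚ.≤ x i) → LPFeasible problem P
    feasible-intro eqs 0≤x = lpFeasible (λ ())
      (λ { zero → trans hubRowValue hub
         ; (suc r) → ++-elim (λ r → TM-row problem (suc r) P ≡ 1ℚ)
             (λ j → trans (rowAValue j) (eqA j))
             (++-elim (λ r → TM-row problem (suc (k ↑ʳ r)) P ≡ 1ℚ)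
               (λ j → trans (rowBValue j) (eqB j)) (λ j → trans (rowCValue j) (eqC j))) r })
      (λ ()) (λ ())
      (nonNegative⇒lowX problem ((λ _ → refl) , (λ _ → refl)) {x = x} 0≤x)
      (noUpperBound problem ((λ _ → refl) , (λ _ → refl)) {x = x})
      where open CycleEquations eqs

    feasible-elim : LPFeasible problem P → CycleEquations × (∀ i → 0ℚ ℚ.≤ x i)
    feasible-elim feasible = eqs , lowX⇒nonNegative problem ((λ _ → refl) , (λ _ → refl)) lowX
      where
      open LPFeasible feasible
      eqs : CycleEquations
      eqs = record
        { hub = trans (sym hubRowValue) (eqTM zero)
        ; eqA = λ j → trans (sym (rowAValue j)) (eqTM (rowAVar j))
        ; eqB = λ j → trans (sym (rowBValue j)) (eqTM (rowBVar j))
        ; eqC = λ j → trans (sym (rowCValue j)) (eqTM (rowCVar j))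
        }

  halves zerosℚ : Fin k → ℚ
  halves _ = half
  zerosℚ _ = 0ℚ

  vertexX : Fin n₀ → ℚ
  vertexX = layout (ι (+ k)) halves halves halves zerosℚ

  witnessX : Fin n₀ → ℤ
  witnessX = layout (+ 0) zeros ones zeros ones

  vertex : Point 0 n₀
  vertex = (λ ()) , vertexX

  witness : IntPoint 0 n₀
  witness = (λ ()) , witnessX

  module V = Layout (ι (+ k)) halves halves halves zerosℚ
  module W = Layout (+ 0) zeros ones zeros ones

  0≤half : 0ℚ ℚ.≤ half
  0≤half = ℚ.*≤* (ℤ.+≤+ ℕ.z≤n)

  vertex-feasible : LPFeasible problem vertex
  vertex-feasible = feasible-intro vertex
    (record
      { hub = trans (cong (ι (+ k) ℚ.+_) (Σℚ-zero k V.lookup-f)) (ℚₚ.+-identityʳ _)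
      ; eqA = λ j → cong₂ ℚ._+_ (V.lookup-a j) (cong₂ ℚ._+_ (V.lookup-c j) (V.lookup-f j))
      ; eqB = λ j → cong₂ ℚ._+_ (V.lookup-a j) (V.lookup-b j)
      ; eqC = λ j → cong₂ ℚ._+_ (V.lookup-b j) (V.lookup-c j)
      })
    (layout-all (0ℚ ℚ.≤_) (0≤ι+ k) (λ _ → 0≤half) (λ _ → 0≤half) (λ _ → 0≤half) (λ _ → ℚₚ.≤-refl))

  witness-feasible : IntFeasible problem witness
  witness-feasible = feasible-intro (embed witness)
    (record
      { hub = trans (ℚₚ.+-identityˡ _) (trans (Σℚ-cong k (λ j → cong ι (W.lookup-f j)))
                (trans (Σℚ-const-ι k 1) (cong (λ z → ι (+ z)) (ℕₚ.*-identityʳ k))))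
      ; eqA = λ j → cong₂ ℚ._+_ (cong ι (W.lookup-a j))
                       (cong₂ ℚ._+_ (cong ι (W.lookup-c j)) (cong ι (W.lookup-f j)))
      ; eqB = λ j → cong₂ ℚ._+_ (cong ι (W.lookup-a j)) (cong ι (W.lookup-b j))
      ; eqC = λ j → cong₂ ℚ._+_ (cong ι (W.lookup-b j)) (cong ι (W.lookup-c j))
      })
    (layout-all (λ z → 0ℚ ℚ.≤ ι z) ℚₚ.≤-refl (λ _ → ℚₚ.≤-refl) (λ _ → 0≤ι+ 1) (λ _ → ℚₚ.≤-refl) (λ _ → 0≤ι+ 1))

  -- At the vertex f = 0 is the midpoint of two nonnegative values, so both are 0;
  -- then a = c and 2a = 1 determine everything else.
  isVertex : IsLPVertex problem vertex
  isVertex = vertex-feasible , unique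
    where
    unique : ∀ P R → LPFeasible problem P → LPFeasible problem R → IsMidpoint vertex P R → SamePoint P R
    unique P R fP fR (_ , midX) = (λ ()) , sameX
      where
      module EP = CycleEquations (proj₁ (feasible-elim P fP))
      module ER = CycleEquations (proj₁ (feasible-elim R fR))
      0≤P : ∀ i → 0ℚ ℚ.≤ proj₂ P i
      0≤P = proj₂ (feasible-elim P fP)
      0≤R : ∀ i → 0ℚ ℚ.≤ proj₂ R i
      0≤R = proj₂ (feasible-elim R fR)
      f-mid : ∀ j → 0ℚ ≡ half ℚ.* (proj₂ P (fVar j) ℚ.+ proj₂ R (fVar j))
      f-mid j = trans (sym (V.lookup-f j)) (midX (fVar j))
      fP≡0 : ∀ j → proj₂ P (fVar j) ≡ 0ℚ
      fP≡0 j = nonNegative-midpoint-zero (0≤P (fVar j)) (0≤R (fVar j)) (f-mid j)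
      fR≡0 : ∀ j → proj₂ R (fVar j) ≡ 0ℚ
      fR≡0 j = nonNegative-midpoint-zero (0≤R (fVar j)) (0≤P (fVar j))
                 (trans (f-mid j) (cong (half ℚ.*_) (ℚₚ.+-comm (proj₂ P (fVar j)) (proj₂ R (fVar j)))))
      a≡ : ∀ j → proj₂ P (aVar j) ≡ proj₂ R (aVar j)
      a≡ j = double-injective (trans (EP.a+a≡1 j (fP≡0 j)) (sym (ER.a+a≡1 j (fR≡0 j))))
      b≡ : ∀ j → proj₂ P (bVar j) ≡ proj₂ R (bVar j)
      b≡ j = rightSummand-unique (EP.eqB j) (ER.eqB j) (a≡ j)
      c≡ : ∀ j → proj₂ P (cVar j) ≡ proj₂ R (cVar j)
      c≡ j = trans (sym (EP.a≡c j)) (trans (a≡ j) (ER.a≡c j))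
      f≡ : ∀ j → proj₂ P (fVar j) ≡ proj₂ R (fVar j)
      f≡ j = trans (fP≡0 j) (sym (fR≡0 j))
      s≡ : proj₂ P zero ≡ proj₂ R zero
      s≡ = leftSummand-unique EP.hub ER.hub (Σℚ-cong k f≡)
      sameX : ∀ v → proj₂ P v ≡ proj₂ R v
      sameX = layout-elim _ s≡ a≡ b≡ c≡ f≡

  integral-pivot : ∀ w → IntFeasible problem w → proj₂ w zero ≡ + 0
  integral-pivot w fw = nonNegative-summand-zero hub-ℤ k≤Σf (0≤w zero)
    where
    open CycleEquations (proj₁ (feasible-elim (embed w) fw))
    x : Fin n₀ → ℤ
    x = proj₂ w
    0≤w : ∀ i → + 0 ℤ.≤ x i
    0≤w i = ι-cancel-≤ {+ 0} (proj₂ (feasible-elim (embed w) fw) i)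
    1≤f : ∀ j → + 1 ℤ.≤ x (fVar j)
    1≤f j = 1≤f-of-2a+f≡1 (0≤w (aVar j)) (0≤w (fVar j)) (ι-injective (begin
      ι (x (aVar j) ℤ.+ (x (aVar j) ℤ.+ x (fVar j)))
        ≡⟨ trans (ι-homo-+ (x (aVar j)) _) (cong (ι (x (aVar j)) ℚ.+_) (ι-homo-+ (x (aVar j)) (x (fVar j)))) ⟩
      ι (x (aVar j)) ℚ.+ (ι (x (aVar j)) ℚ.+ ι (x (fVar j)))
        ≡⟨ a+[a+f]≡1 j ⟩
      1ℚ ∎))
      where open ≡-Reasoning
    hub-ℤ : x zero ℤ.+ Σℤ k (λ j → x (fVar j)) ≡ + k
    hub-ℤ = ι-injective (trans (ι-homo-+ (x zero) _)
              (trans (cong (ι (x zero) ℚ.+_) (sym (Σℚ-ι k (λ j → x (fVar j))))) hub))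
    k≤Σf : + k ℤ.≤ Σℤ k (λ j → x (fVar j))
    k≤Σf = subst (ℤ._≤ Σℤ k (λ j → x (fVar j))) (trans (Σℤ-const k (+ 1)) (ℤₚ.*-identityʳ (+ k)))
                 (Σℤ-mono-≤ k 1≤f)

  M₀-column : ∀ v → ∥ (λ r → M₀ r v) ∥₁ ≡
    + ℤ.∣ hubRow v ∣ ℤ.+ (∥ (λ j → rowA j v) ∥₁ ℤ.+ (∥ (λ j → rowB j v) ∥₁ ℤ.+ ∥ (λ j → rowC j v) ∥₁))
  M₀-column v = cong (λ z → + ℤ.∣ hubRow v ∣ ℤ.+ z)
    (trans (∥∥₁-cong (λ r → ++-column rowA (rowB ++ rowC) r v))
      (trans (∥++∥₁ (λ j → rowA j v) (λ j → (rowB ++ rowC) j v))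
        (cong (λ z → ∥ (λ j → rowA j v) ∥₁ ℤ.+ z)
          (trans (∥∥₁-cong (λ r → ++-column rowB rowC r v)) (∥++∥₁ (λ j → rowB j v) (λ j → rowC j v))))))

  column-indicator : ∀ {R : Fin k → ℤ} j' → (∀ j → R j ≡ indicator j j') → ∥ R ∥₁ ≡ + 1
  column-indicator j' R≗ = trans (∥∥₁-cong R≗) (∥indicator-column∥₁ j')

  column-zeros : ∀ {R : Fin k → ℤ} → (∀ j → R j ≡ + 0) → ∥ R ∥₁ ≡ + 0
  column-zeros R≗ = trans (∥∥₁-cong R≗) (∥zeros∥₁ k)

  M₀-pivotColumn : ∥ (λ r → M₀ r zero) ∥₁ ≡ + 1
  M₀-pivotColumn = trans (M₀-column zero)
    (cong (λ z → + 1 ℤ.+ z) (cong₂ ℤ._+_ (∥zeros∥₁ k) (cong₂ ℤ._+_ (∥zeros∥₁ k) (∥zeros∥₁ k))))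

  M₀-columns : ∀ v → ∥ (λ r → M₀ r v) ∥₁ ℤ.≤ + 2
  M₀-columns v = ℤₚ.≤-trans (ℤₚ.≤-reflexive (M₀-column v)) (layout-elim
    (λ v → + ℤ.∣ hubRow v ∣ ℤ.+ (∥ (λ j → rowA j v) ∥₁ ℤ.+ (∥ (λ j → rowB j v) ∥₁ ℤ.+ ∥ (λ j → rowC j v) ∥₁))
             ℤ.≤ + 2)
    (ℤₚ.≤-trans (ℤₚ.≤-reflexive (trans (sym (M₀-column zero)) M₀-pivotColumn)) (ℤ.+≤+ (ℕ.s≤s ℕ.z≤n)))
    (λ j' → ℤₚ.≤-reflexive (cong₂ (λ h z → + ℤ.∣ h ∣ ℤ.+ z) (Hub.lookup-a j')
      (cong₂ ℤ._+_ (column-indicator j' (λ j → RowA.lookup-a j j'))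
        (cong₂ ℤ._+_ (column-indicator j' (λ j → RowB.lookup-a j j'))
                     (column-zeros (λ j → RowC.lookup-a j j'))))))
    (λ j' → ℤₚ.≤-reflexive (cong₂ (λ h z → + ℤ.∣ h ∣ ℤ.+ z) (Hub.lookup-b j')
      (cong₂ ℤ._+_ (column-zeros (λ j → RowA.lookup-b j j'))
        (cong₂ ℤ._+_ (column-indicator j' (λ j → RowB.lookup-b j j'))
                     (column-indicator j' (λ j → RowC.lookup-b j j'))))))
    (λ j' → ℤₚ.≤-reflexive (cong₂ (λ h z → + ℤ.∣ h ∣ ℤ.+ z) (Hub.lookup-c j')
      (cong₂ ℤ._+_ (column-indicator j' (λ j → RowA.lookup-c j j'))
        (cong₂ ℤ._+_ (column-zeros (λ j → RowB.lookup-c j j'))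
                     (column-indicator j' (λ j → RowC.lookup-c j j'))))))
    (λ j' → ℤₚ.≤-reflexive (cong₂ (λ h z → + ℤ.∣ h ∣ ℤ.+ z) (Hub.lookup-f j')
      (cong₂ ℤ._+_ (column-indicator j' (λ j → RowA.lookup-f j j'))
        (cong₂ ℤ._+_ (column-zeros (λ j → RowB.lookup-f j j'))
                     (column-zeros (λ j → RowC.lookup-f j j'))))))
    v)

  M₀∈01Δ : ∀ r v → In01Δ Δ (M₀ r v)
  M₀∈01Δ zero = layout-all (In01Δ Δ) one∈01Δ (λ _ → zero∈01Δ) (λ _ → zero∈01Δ) (λ _ → zero∈01Δ) (λ _ → one∈01Δ)
  M₀∈01Δ (suc r) = ++-all (λ R → ∀ v → In01Δ Δ (R v)) {f = rowA} {g = rowB ++ rowC}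
    (λ j → layout-all (In01Δ Δ) zero∈01Δ (indicator∈01Δ j) (λ _ → zero∈01Δ) (indicator∈01Δ j) (indicator∈01Δ j))
    (++-all (λ R → ∀ v → In01Δ Δ (R v)) {f = rowB} {g = rowC}
      (λ j → layout-all (In01Δ Δ) zero∈01Δ (indicator∈01Δ j) (indicator∈01Δ j) (λ _ → zero∈01Δ) (λ _ → zero∈01Δ))
      (λ j → layout-all (In01Δ Δ) zero∈01Δ (λ _ → zero∈01Δ) (indicator∈01Δ j) (indicator∈01Δ j) (λ _ → zero∈01Δ)))
    r

  hardInstance : HardInstance Δ 0 0 m₀ n₀
  hardInstance = record
    { problem = problem ; pivot = zero ; gap = k
    ; vertex = vertex ; witness = witness
    ; columns≤2 = M₀-columns
    ; pivotColumn≤1 = ℤₚ.≤-reflexive M₀-pivotColumn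
    ; standardBounds = (λ _ → refl) , (λ _ → refl)
    ; coefficients = (λ ()) , (λ ()) , (λ _ ()) , M₀∈01Δ
    ; isVertex = isVertex
    ; witnessFeasible = witness-feasible
    ; vertex-pivot = refl
    ; integral-pivot = integral-pivot
    }

-- Adding an integer variable t with 0 ≤ t ≤ D (D the gap) and the rows
--   t + x_pivot = D,   s + Σⱼ vⱼ = kΔD,   s + o = kΔD,   Δ t + vⱼ = ΔD  (j < k).
-- At the vertex x_pivot = D forces t = 0, vⱼ = ΔD, s = 0, o = kΔD; at an integral
-- point x_pivot = 0 forces t = D, vⱼ = 0, s = kΔD, o = 0.  The new pivot is o.

module AddIntegerVariable (k₀ : ℕ) {Δ p h m n : ℕ} (B : HardInstance Δ p h m n) where
  open HardInstance B
  open Tie B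

  k : ℕ
  k = suc k₀

  gap' : ℕ
  gap' = k * (Δ * gap)

  newM : Fin (3 + k) → Fin (2 + k) → ℤ
  newM = zeros
       ∷ (+ 1 ∷ + 0 ∷ ones)
       ∷ (+ 1 ∷ + 1 ∷ zeros)
       ∷ (λ j → + 0 ∷ + 0 ∷ indicator j)

  newT newb : Fin (3 + k) → ℤ
  newT = + 1 ∷ + 0 ∷ + 0 ∷ (λ _ → + Δ)
  newb = + gap ∷ + gap' ∷ + gap' ∷ (λ _ → + (Δ * gap))

  newTRows : Fin (3 + k) → Fin (suc p) → ℤ
  newTRows i = newT i ∷ zeros

  oldTRows : Fin m → Fin (suc p) → ℤ
  oldTRows r = + 0 ∷ T problem r

  problem' : Instance (suc p) h (3 + k + m) (2 + k + n)
  problem' = record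
    { a = zeros ; c = zeros
    ; C = λ i → + 0 ∷ C problem i ; W = λ i → zeros ++ W problem i
    ; T = newTRows ++ oldTRows ; M = extendM newM
    ; d = d problem ; b = newb ++ b problem
    ; e = + 0 ∷ e problem ; g = + gap ∷ g problem
    ; l = zeros ; u = λ _ → nothing }

  oldVar : Fin n → Fin (2 + k + n)
  oldVar i = (2 + k) ↑ʳ i

  fanVar : Fin k → Fin (2 + k + n)
  fanVar j = suc (suc (j ↑ˡ n))

  restrict : Point (suc p) (2 + k + n) → Point p n
  restrict P = (λ j → proj₁ P (suc j)) , (λ i → proj₂ P (oldVar i))

  newRow : ∀ i P → TM-row problem' (i ↑ˡ m) P ≡
    ι (newT i) ℚ.* proj₁ P zero ℚ.+
      (newM i · (λ j → proj₂ P (j ↑ˡ n)) ℚ.+ tieRows i · (λ j → proj₂ P (oldVar j)))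
  newRow i P = cong₂ ℚ._+_
    (trans (·-congˡ (proj₁ P) (λ v → cong (λ A → A v) (lookup-++ˡ newTRows oldTRows i)))
           (∷zeros-· (newT i) (proj₁ P)))
    (extendM-newRow newM i (proj₂ P))

  oldRow : ∀ r P → TM-row problem' ((3 + k) ↑ʳ r) P ≡ TM-row problem r (restrict P)
  oldRow r P = cong₂ ℚ._+_
    (trans (·-congˡ (proj₁ P) (λ v → cong (λ A → A v) (lookup-++ʳ newTRows oldTRows r)))
           (zero∷-· (T problem r) (proj₁ P)))
    (extendM-oldRow newM r (proj₂ P))

  oldCWRow : ∀ i P → CW-row problem' i P ≡ CW-row problem i (restrict P)
  oldCWRow i P = cong₂ ℚ._+_ (zero∷-· (C problem i) (proj₁ P)) (zeros++-· (W problem i) (proj₂ P))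

  module _ (P : Point (suc p) (2 + k + n)) where
    private
      t s o : ℚ
      t = proj₁ P zero
      s = proj₂ P zero
      o = proj₂ P (suc zero)
      v : Fin k → ℚ
      v j = proj₂ P (fanVar j)
      x : Fin n → ℚ
      x i = proj₂ P (oldVar i)
      y : Fin (2 + k) → ℚ
      y j = proj₂ P (j ↑ˡ n)

    tieRow : TM-row problem' zero P ≡ t ℚ.+ x pivot
    tieRow = begin
      TM-row problem' zero P
        ≡⟨ newRow zero P ⟩
      ι (+ 1) ℚ.* t ℚ.+ (zeros · y ℚ.+ indicator pivot · x)
        ≡⟨ cong₂ ℚ._+_ (ℚₚ.*-identityˡ t) (cong (ℚ._+ indicator pivot · x) (zeros-· y)) ⟩
      t ℚ.+ (0ℚ ℚ.+ indicator pivot · x)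
        ≡⟨ cong (t ℚ.+_) (trans (ℚₚ.+-identityˡ _) (indicator-· pivot x)) ⟩
      t ℚ.+ x pivot ∎
      where open ≡-Reasoning

    sumRow : TM-row problem' (suc zero) P ≡ s ℚ.+ Σℚ k v
    sumRow = begin
      TM-row problem' (suc zero) P
        ≡⟨ newRow (suc zero) P ⟩
      ι (+ 0) ℚ.* t ℚ.+ ((ι (+ 1) ℚ.* s ℚ.+ (ι (+ 0) ℚ.* o ℚ.+ ones · v)) ℚ.+ zeros · x)
        ≡⟨ cong₂ ℚ._+_ (ℚₚ.*-zeroˡ t) (cong₂ ℚ._+_
             (cong₂ ℚ._+_ (ℚₚ.*-identityˡ s) (cong₂ ℚ._+_ (ℚₚ.*-zeroˡ o) (ones-· v))) (zeros-· x)) ⟩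
      0ℚ ℚ.+ ((s ℚ.+ (0ℚ ℚ.+ Σℚ k v)) ℚ.+ 0ℚ)
        ≡⟨ trans (ℚₚ.+-identityˡ _) (trans (ℚₚ.+-identityʳ _) (cong (s ℚ.+_) (ℚₚ.+-identityˡ _))) ⟩
      s ℚ.+ Σℚ k v ∎
      where open ≡-Reasoning

    outRow : TM-row problem' (suc (suc zero)) P ≡ s ℚ.+ o
    outRow = begin
      TM-row problem' (suc (suc zero)) P
        ≡⟨ newRow (suc (suc zero)) P ⟩
      ι (+ 0) ℚ.* t ℚ.+ ((ι (+ 1) ℚ.* s ℚ.+ (ι (+ 1) ℚ.* o ℚ.+ zeros · v)) ℚ.+ zeros · x)
        ≡⟨ cong₂ ℚ._+_ (ℚₚ.*-zeroˡ t) (cong₂ ℚ._+_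
             (cong₂ ℚ._+_ (ℚₚ.*-identityˡ s) (cong₂ ℚ._+_ (ℚₚ.*-identityˡ o) (zeros-· v))) (zeros-· x)) ⟩
      0ℚ ℚ.+ ((s ℚ.+ (o ℚ.+ 0ℚ)) ℚ.+ 0ℚ)
        ≡⟨ trans (ℚₚ.+-identityˡ _) (trans (ℚₚ.+-identityʳ _) (cong (s ℚ.+_) (ℚₚ.+-identityʳ o))) ⟩
      s ℚ.+ o ∎
      where open ≡-Reasoning

    fanRow : ∀ j → TM-row problem' (suc (suc (suc (j ↑ˡ m)))) P ≡ ι (+ Δ) ℚ.* t ℚ.+ v j
    fanRow j = begin
      TM-row problem' (suc (suc (suc (j ↑ˡ m)))) P
        ≡⟨ newRow (suc (suc (suc j))) P ⟩
      ι (+ Δ) ℚ.* t ℚ.+ ((ι (+ 0) ℚ.* s ℚ.+ (ι (+ 0) ℚ.* o ℚ.+ indicator j · v)) ℚ.+ zeros · x)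
        ≡⟨ cong (ι (+ Δ) ℚ.* t ℚ.+_) (cong₂ ℚ._+_
             (cong₂ ℚ._+_ (ℚₚ.*-zeroˡ s) (cong₂ ℚ._+_ (ℚₚ.*-zeroˡ o) (indicator-· j v))) (zeros-· x)) ⟩
      ι (+ Δ) ℚ.* t ℚ.+ ((0ℚ ℚ.+ (0ℚ ℚ.+ v j)) ℚ.+ 0ℚ)
        ≡⟨ cong (ι (+ Δ) ℚ.* t ℚ.+_) (trans (ℚₚ.+-identityʳ _) (trans (ℚₚ.+-identityˡ _) (ℚₚ.+-identityˡ _))) ⟩
      ι (+ Δ) ℚ.* t ℚ.+ v j ∎
      where open ≡-Reasoning

    record GadgetEquations : Set where
      field
        tie : t ℚ.+ x pivot ≡ ι (+ gap)
        sum : s ℚ.+ Σℚ k v ≡ ι (+ gap')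
        out : s ℚ.+ o ≡ ι (+ gap')
        fan : ∀ j → ι (+ Δ) ℚ.* t ℚ.+ v j ≡ ι (+ (Δ * gap))

    feasible-intro : LPFeasible problem (restrict P) → GadgetEquations →
      0ℚ ℚ.≤ t → t ℚ.≤ ι (+ gap) → 0ℚ ℚ.≤ s → 0ℚ ℚ.≤ o → (∀ j → 0ℚ ℚ.≤ v j) →
      LPFeasible problem' P
    feasible-intro old eqs 0≤t t≤D 0≤s 0≤o 0≤v = lpFeasible
      (λ i → trans (oldCWRow i P) (eqCW i))
      (++-elim (λ r → TM-row problem' r P ≡ ι ((newb ++ b problem) r))
        (λ i → trans (newRows i) (cong ι (sym (lookup-++ˡ newb (b problem) i))))
        (λ r → trans (oldRow r P) (trans (eqTM r) (cong ι (sym (lookup-++ʳ newb (b problem) r))))))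
      (λ { zero → 0≤t ; (suc j) → lowY j })
      (λ { zero → t≤D ; (suc j) → uppY j })
      (nonNegative⇒lowX problem' ((λ _ → refl) , (λ _ → refl)) {x = proj₂ P} (++-elim _
        (λ { zero → 0≤s ; (suc zero) → 0≤o ; (suc (suc j)) → 0≤v j })
        (lowX⇒nonNegative problem standardBounds lowX)))
      (noUpperBound problem' ((λ _ → refl) , (λ _ → refl)) {x = proj₂ P})
      where
      open LPFeasible old
      open GadgetEquations eqs
      newRows : ∀ i → TM-row problem' (i ↑ˡ m) P ≡ ι (newb i)
      newRows zero                = trans tieRow tie
      newRows (suc zero)          = trans sumRow sum
      newRows (suc (suc zero))    = trans outRow out
      newRows (suc (suc (suc j))) = trans (fanRow j) (fan j)

    feasible-elim : LPFeasible problem' P → LPFeasible problem (restrict P) × GadgetEquations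
    feasible-elim new = old , eqs
      where
      open LPFeasible new
      old : LPFeasible problem (restrict P)
      old = lpFeasible
        (λ i → trans (sym (oldCWRow i P)) (eqCW i))
        (λ r → trans (sym (oldRow r P))
                 (trans (eqTM ((3 + k) ↑ʳ r)) (cong ι (lookup-++ʳ newb (b problem) r))))
        (λ j → lowY (suc j)) (λ j → uppY (suc j))
        (nonNegative⇒lowX problem standardBounds {x = x} (λ i → lowX (oldVar i)))
        (noUpperBound problem standardBounds {x = x})
      newRows : ∀ i → TM-row problem' (i ↑ˡ m) P ≡ ι (newb i)
      newRows i = trans (eqTM (i ↑ˡ m)) (cong ι (lookup-++ˡ newb (b problem) i))
      eqs : GadgetEquations
      eqs = record
        { tie = trans (sym tieRow) (newRows zero)
        ; sum = trans (sym sumRow) (newRows (suc zero))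
        ; out = trans (sym outRow) (newRows (suc (suc zero)))
        ; fan = λ j → trans (sym (fanRow j)) (newRows (suc (suc (suc j))))
        }

  vertexNew : Fin (2 + k) → ℚ
  vertexNew = 0ℚ ∷ ι (+ gap') ∷ (λ _ → ι (+ (Δ * gap)))

  witnessNew : Fin (2 + k) → ℤ
  witnessNew = + gap' ∷ + 0 ∷ zeros

  vertex' : Point (suc p) (2 + k + n)
  vertex' = (0ℚ ∷ proj₁ vertex) , (vertexNew ++ proj₂ vertex)

  witness' : IntPoint (suc p) (2 + k + n)
  witness' = (+ gap ∷ proj₁ witness) , (witnessNew ++ proj₂ witness)

  vertex'-old : ∀ i → proj₂ vertex' (oldVar i) ≡ proj₂ vertex i
  vertex'-old = lookup-++ʳ vertexNew (proj₂ vertex)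

  witness'-old : ∀ i → proj₂ witness' (oldVar i) ≡ proj₂ witness i
  witness'-old = lookup-++ʳ witnessNew (proj₂ witness)

  vertex'-fan : ∀ j → proj₂ vertex' (fanVar j) ≡ ι (+ (Δ * gap))
  vertex'-fan j = lookup-++ˡ vertexNew (proj₂ vertex) (suc (suc j))

  witness'-fan : ∀ j → proj₂ witness' (fanVar j) ≡ + 0
  witness'-fan j = lookup-++ˡ witnessNew (proj₂ witness) (suc (suc j))

  vertex'-feasible : LPFeasible problem' vertex'
  vertex'-feasible = feasible-intro vertex'
    (LPFeasible-cong problem (λ _ → refl) (λ i → sym (vertex'-old i)) (proj₁ isVertex))
    (record
      { tie = trans (ℚₚ.+-identityˡ _) (trans (vertex'-old pivot) vertex-pivot)
      ; sum = trans (ℚₚ.+-identityˡ _) (trans (Σℚ-cong k vertex'-fan) (Σℚ-const-ι k (Δ * gap)))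
      ; out = ℚₚ.+-identityˡ _
      ; fan = λ j → trans (cong₂ ℚ._+_ (ℚₚ.*-zeroʳ (ι (+ Δ))) (vertex'-fan j)) (ℚₚ.+-identityˡ _)
      })
    ℚₚ.≤-refl (0≤ι+ gap) ℚₚ.≤-refl (0≤ι+ gap')
    (λ j → subst (0ℚ ℚ.≤_) (sym (vertex'-fan j)) (0≤ι+ (Δ * gap)))

  witness'-feasible : IntFeasible problem' witness'
  witness'-feasible = feasible-intro (embed witness')
    (LPFeasible-cong problem (λ _ → refl) (λ i → cong ι (sym (witness'-old i))) witnessFeasible)
    (record
      { tie = trans (cong (ι (+ gap) ℚ.+_) (cong ι (trans (witness'-old pivot)
                (integral-pivot witness witnessFeasible)))) (ℚₚ.+-identityʳ _)
      ; sum = trans (cong (ι (+ gap') ℚ.+_) (Σℚ-zero k (λ j → cong ι (witness'-fan j)))) (ℚₚ.+-identityʳ _)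
      ; out = ℚₚ.+-identityʳ _
      ; fan = λ j → trans (cong₂ ℚ._+_ (sym (ι-homo-ℕ* Δ gap)) (cong ι (witness'-fan j))) (ℚₚ.+-identityʳ _)
      })
    (0≤ι+ gap) ℚₚ.≤-refl (0≤ι+ gap') ℚₚ.≤-refl
    (λ j → subst (λ z → 0ℚ ℚ.≤ ι z) (sym (witness'-fan j)) ℚₚ.≤-refl)

  -- Every new coordinate is determined by the old ones through the gadget equations.
  isVertex' : IsLPVertex problem' vertex'
  isVertex' = vertex'-feasible , unique
    where
    unique : ∀ P R → LPFeasible problem' P → LPFeasible problem' R → IsMidpoint vertex' P R → SamePoint P R
    unique P R fP fR (midY , midX) = sameY , sameX
      where
      module EP = GadgetEquations (proj₂ (feasible-elim P fP))
      module ER = GadgetEquations (proj₂ (feasible-elim R fR))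
      old-same : SamePoint (restrict P) (restrict R)
      old-same = proj₂ isVertex (restrict P) (restrict R)
        (proj₁ (feasible-elim P fP)) (proj₁ (feasible-elim R fR))
        ((λ j → midY (suc j)) , (λ i → trans (sym (vertex'-old i)) (midX (oldVar i))))
      t≡ : proj₁ P zero ≡ proj₁ R zero
      t≡ = leftSummand-unique EP.tie ER.tie (proj₂ old-same pivot)
      v≡ : ∀ j → proj₂ P (fanVar j) ≡ proj₂ R (fanVar j)
      v≡ j = rightSummand-unique (EP.fan j) (ER.fan j) (cong (ι (+ Δ) ℚ.*_) t≡)
      s≡ : proj₂ P zero ≡ proj₂ R zero
      s≡ = leftSummand-unique EP.sum ER.sum (Σℚ-cong k v≡)
      o≡ : proj₂ P (suc zero) ≡ proj₂ R (suc zero)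
      o≡ = rightSummand-unique EP.out ER.out s≡
      sameY : ∀ j → proj₁ P j ≡ proj₁ R j
      sameY zero    = t≡
      sameY (suc j) = proj₁ old-same j
      sameX : ∀ i → proj₂ P i ≡ proj₂ R i
      sameX = ++-elim _ (λ { zero → s≡ ; (suc zero) → o≡ ; (suc (suc j)) → v≡ j }) (proj₂ old-same)

  integral-pivot' : ∀ w → IntFeasible problem' w → proj₂ w (suc zero) ≡ + 0
  integral-pivot' w fw = ι-injective o≡0
    where
    open GadgetEquations (proj₂ (feasible-elim (embed w) fw))
    x-pivot≡0 : ι (proj₂ w (oldVar pivot)) ≡ 0ℚ
    x-pivot≡0 = cong ι (integral-pivot ((λ j → proj₁ w (suc j)) , (λ i → proj₂ w (oldVar i)))
                                        (proj₁ (feasible-elim (embed w) fw)))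
    t≡D : ι (proj₁ w zero) ≡ ι (+ gap)
    t≡D = leftSummand-unique tie (ℚₚ.+-identityʳ _) x-pivot≡0
    v≡0 : ∀ j → ι (proj₂ w (fanVar j)) ≡ 0ℚ
    v≡0 j = rightSummand-unique (fan j) (trans (ℚₚ.+-identityʳ _) (sym (ι-homo-ℕ* Δ gap)))
                                (cong (ι (+ Δ) ℚ.*_) t≡D)
    s≡D' : ι (proj₂ w zero) ≡ ι (+ gap')
    s≡D' = leftSummand-unique sum (ℚₚ.+-identityʳ _) (Σℚ-zero k v≡0)
    o≡0 : ι (proj₂ w (suc zero)) ≡ 0ℚ
    o≡0 = rightSummand-unique out (ℚₚ.+-identityʳ _) s≡D'

  newM-columns : ∀ j → ∥ (λ i → newM i j) ∥₁ ℤ.≤ + 2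
  newM-columns zero          = ℤₚ.≤-reflexive (cong (λ z → + 0 ℤ.+ (+ 1 ℤ.+ (+ 1 ℤ.+ z))) (∥zeros∥₁ k))
  newM-columns (suc zero)    = ℤₚ.≤-trans
    (ℤₚ.≤-reflexive (cong (λ z → + 0 ℤ.+ (+ 0 ℤ.+ (+ 1 ℤ.+ z))) (∥zeros∥₁ k))) (ℤ.+≤+ (ℕ.s≤s ℕ.z≤n))
  newM-columns (suc (suc j)) =
    ℤₚ.≤-reflexive (cong (λ z → + 0 ℤ.+ (+ 1 ℤ.+ (+ 0 ℤ.+ z))) (∥indicator-column∥₁ j))

  pivotColumn≤1' : ∥ (λ r → M problem' r (suc zero)) ∥₁ ℤ.≤ + 1
  pivotColumn≤1' = ℤₚ.≤-reflexive (trans (blockUpper-leftColumn newM tieRows (M problem) (suc zero))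
    (cong (λ z → + 0 ℤ.+ (+ 0 ℤ.+ (+ 1 ℤ.+ z))) (∥zeros∥₁ k)))

  newT∈01Δ : ∀ i → In01Δ Δ (newT i)
  newT∈01Δ zero                = one∈01Δ
  newT∈01Δ (suc zero)          = zero∈01Δ
  newT∈01Δ (suc (suc zero))    = zero∈01Δ
  newT∈01Δ (suc (suc (suc _))) = Δ∈01Δ

  newM∈01Δ : ∀ i j → In01Δ Δ (newM i j)
  newM∈01Δ zero                _             = zero∈01Δ
  newM∈01Δ (suc zero)          zero          = one∈01Δ
  newM∈01Δ (suc zero)          (suc zero)    = zero∈01Δ
  newM∈01Δ (suc zero)          (suc (suc _)) = one∈01Δ
  newM∈01Δ (suc (suc zero))    zero          = one∈01Δ
  newM∈01Δ (suc (suc zero))    (suc zero)    = one∈01Δ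
  newM∈01Δ (suc (suc zero))    (suc (suc _)) = zero∈01Δ
  newM∈01Δ (suc (suc (suc i))) zero          = zero∈01Δ
  newM∈01Δ (suc (suc (suc i))) (suc zero)    = zero∈01Δ
  newM∈01Δ (suc (suc (suc i))) (suc (suc j)) = indicator∈01Δ i j

  coefficients' : CoeffsIn01Δ Δ problem'
  coefficients' = C∈ , W∈ , T∈ , extendM-∈01Δ newM newM∈01Δ
    where
    C∈ : ∀ i j → In01Δ Δ (C problem' i j)
    C∈ i zero    = zero∈01Δ
    C∈ i (suc j) = proj₁ coefficients i j
    W∈ : ∀ i j → In01Δ Δ (W problem' i j)
    W∈ i = ++-all (In01Δ Δ) {f = zeros} (λ _ → zero∈01Δ) (proj₁ (proj₂ coefficients) i)
    newT∈ : ∀ i j → In01Δ Δ (newTRows i j)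
    newT∈ i zero    = newT∈01Δ i
    newT∈ i (suc j) = zero∈01Δ
    oldT∈ : ∀ r j → In01Δ Δ (oldTRows r j)
    oldT∈ r zero    = zero∈01Δ
    oldT∈ r (suc j) = proj₁ (proj₂ (proj₂ coefficients)) r j
    T∈ : ∀ r j → In01Δ Δ (T problem' r j)
    T∈ = ++-all (λ A → ∀ j → In01Δ Δ (A j)) {f = newTRows} {g = oldTRows} newT∈ oldT∈

  hardInstance : HardInstance Δ (suc p) h (3 + k + m) (2 + k + n)
  hardInstance = record
    { problem = problem' ; pivot = suc zero ; gap = gap'
    ; vertex = vertex' ; witness = witness'
    ; columns≤2 = extendM-columns≤2 newM newM-columns
    ; pivotColumn≤1 = pivotColumn≤1'
    ; standardBounds = (λ _ → refl) , (λ _ → refl)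
    ; coefficients = coefficients'
    ; isVertex = isVertex'
    ; witnessFeasible = witness'-feasible
    ; vertex-pivot = refl
    ; integral-pivot = integral-pivot'
    }

-- Adding a coupling row  s + Δ Σⱼ qⱼ = kΔD  together with the chain of rows
--   q₀ + x_pivot = D,   qⱼ₊₁ + rⱼ = D,   qⱼ + rⱼ = D   (j < k).
-- At the vertex x_pivot = D propagates along the chain to q = 0, r = D, so s = kΔD;
-- at an integral point x_pivot = 0 propagates to q = D, r = 0, so s = 0.
-- The new pivot is s, whose M-column is zero.

module AddCouplingRow (k₀ : ℕ) {Δ p h m n : ℕ} (B : HardInstance Δ p h m n) where
  open HardInstance B
  open Tie B

  k : ℕ
  k = suc k₀

  gap' : ℕ
  gap' = k * (Δ * gap)

  predIndicator : Fin k → Fin k → ℤ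
  predIndicator zero    = zeros
  predIndicator (suc j) = indicator (Fin.inject₁ j)

  chainRows pairRows : Fin k → Fin (suc (k + k)) → ℤ
  chainRows j = + 0 ∷ (indicator j ++ predIndicator j)
  pairRows  j = + 0 ∷ (indicator j ++ indicator j)

  newM : Fin (k + k) → Fin (suc (k + k)) → ℤ
  newM = chainRows ++ pairRows

  constΔ : Fin k → ℤ
  constΔ _ = + Δ

  couplingRow : Fin (suc (k + k)) → ℤ
  couplingRow = + 1 ∷ (constΔ ++ zeros)

  newW : Fin (suc h) → Fin (suc (k + k) + n) → ℤ
  newW = (couplingRow ++ zeros) ∷ (λ i → zeros ++ W problem i)

  newTRows : Fin (k + k) → Fin p → ℤ
  newTRows _ = zeros

  newb : Fin (k + k) → ℤ
  newb _ = + gap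

  problem' : Instance p (suc h) (k + k + m) (suc (k + k) + n)
  problem' = record
    { a = zeros ; c = zeros
    ; C = zeros ∷ C problem ; W = newW
    ; T = newTRows ++ T problem ; M = extendM newM
    ; d = + gap' ∷ d problem ; b = newb ++ b problem
    ; e = e problem ; g = g problem
    ; l = zeros ; u = λ _ → nothing }

  oldVar : Fin n → Fin (suc (k + k) + n)
  oldVar i = suc (k + k) ↑ʳ i

  qVar rVar : Fin k → Fin (suc (k + k) + n)
  qVar j = suc ((j ↑ˡ k) ↑ˡ n)
  rVar j = suc ((k ↑ʳ j) ↑ˡ n)

  restrict : Point p (suc (k + k) + n) → Point p n
  restrict P = proj₁ P , (λ i → proj₂ P (oldVar i))

  newRow : ∀ i P → TM-row problem' (i ↑ˡ m) P ≡
    newM i · (λ j → proj₂ P (j ↑ˡ n)) ℚ.+ tieRows i · (λ j → proj₂ P (oldVar j))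
  newRow i P = begin
    TM-row problem' (i ↑ˡ m) P
      ≡⟨ cong₂ ℚ._+_ (·-congˡ (proj₁ P) (λ v → cong (λ A → A v) (lookup-++ˡ newTRows (T problem) i)))
                     (extendM-newRow newM i (proj₂ P)) ⟩
    zeros · proj₁ P ℚ.+ (newM i · (λ j → proj₂ P (j ↑ˡ n)) ℚ.+ tieRows i · (λ j → proj₂ P (oldVar j)))
      ≡⟨ trans (cong (ℚ._+ (newM i · (λ j → proj₂ P (j ↑ˡ n)) ℚ.+ tieRows i · (λ j → proj₂ P (oldVar j))))
                     (zeros-· (proj₁ P))) (ℚₚ.+-identityˡ _) ⟩
    newM i · (λ j → proj₂ P (j ↑ˡ n)) ℚ.+ tieRows i · (λ j → proj₂ P (oldVar j)) ∎
    where open ≡-Reasoning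

  oldRow : ∀ r P → TM-row problem' ((k + k) ↑ʳ r) P ≡ TM-row problem r (restrict P)
  oldRow r P = cong₂ ℚ._+_
    (·-congˡ (proj₁ P) (λ v → cong (λ A → A v) (lookup-++ʳ newTRows (T problem) r)))
    (extendM-oldRow newM r (proj₂ P))

  oldCWRow : ∀ i P → CW-row problem' (suc i) P ≡ CW-row problem i (restrict P)
  oldCWRow i P = cong (C problem i · proj₁ P ℚ.+_) (zeros++-· (W problem i) (proj₂ P))

  module _ (P : Point p (suc (k + k) + n)) where
    private
      s : ℚ
      s = proj₂ P zero
      q r : Fin k → ℚ
      q j = proj₂ P (qVar j)
      r j = proj₂ P (rVar j)
      x : Fin n → ℚ
      x i = proj₂ P (oldVar i)
      y : Fin (suc (k + k)) → ℚ
      y v = proj₂ P (v ↑ˡ n)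

    newVarsRow : ∀ (A A' : Fin k → ℤ) → (+ 0 ∷ (A ++ A')) · y ≡ A · q ℚ.+ A' · r
    newVarsRow A A' = trans (zero∷-· (A ++ A') y) (·-++ A A' (λ v → y (suc v)))

    firstRow : TM-row problem' zero P ≡ q zero ℚ.+ x pivot
    firstRow = begin
      TM-row problem' zero P
        ≡⟨ newRow zero P ⟩
      chainRows zero · y ℚ.+ indicator pivot · x
        ≡⟨ cong₂ ℚ._+_ (newVarsRow (indicator zero) zeros) (indicator-· pivot x) ⟩
      (indicator zero · q ℚ.+ zeros · r) ℚ.+ x pivot
        ≡⟨ cong (ℚ._+ x pivot) (trans (cong₂ ℚ._+_ (indicator-· zero q) (zeros-· r)) (ℚₚ.+-identityʳ (q zero))) ⟩
      q zero ℚ.+ x pivot ∎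
      where open ≡-Reasoning

    chainRow : ∀ j → TM-row problem' ((suc j ↑ˡ k) ↑ˡ m) P ≡ q (suc j) ℚ.+ r (Fin.inject₁ j)
    chainRow j = begin
      TM-row problem' ((suc j ↑ˡ k) ↑ˡ m) P
        ≡⟨ newRow (suc j ↑ˡ k) P ⟩
      newM (suc j ↑ˡ k) · y ℚ.+ zeros · x
        ≡⟨ cong₂ ℚ._+_ (·-congˡ y (λ v → cong (λ A → A v) (lookup-++ˡ chainRows pairRows (suc j)))) (zeros-· x) ⟩
      chainRows (suc j) · y ℚ.+ 0ℚ
        ≡⟨ trans (ℚₚ.+-identityʳ _) (trans (newVarsRow (indicator (suc j)) (indicator (Fin.inject₁ j)))
             (cong₂ ℚ._+_ (indicator-· (suc j) q) (indicator-· (Fin.inject₁ j) r))) ⟩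
      q (suc j) ℚ.+ r (Fin.inject₁ j) ∎
      where open ≡-Reasoning

    pairRow : ∀ j → TM-row problem' ((k ↑ʳ j) ↑ˡ m) P ≡ q j ℚ.+ r j
    pairRow j = begin
      TM-row problem' ((k ↑ʳ j) ↑ˡ m) P
        ≡⟨ newRow (k ↑ʳ j) P ⟩
      newM (k ↑ʳ j) · y ℚ.+ zeros · x
        ≡⟨ cong₂ ℚ._+_ (·-congˡ y (λ v → cong (λ A → A v) (lookup-++ʳ chainRows pairRows j))) (zeros-· x) ⟩
      pairRows j · y ℚ.+ 0ℚ
        ≡⟨ trans (ℚₚ.+-identityʳ _) (trans (newVarsRow (indicator j) (indicator j))
             (cong₂ ℚ._+_ (indicator-· j q) (indicator-· j r))) ⟩
      q j ℚ.+ r j ∎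
      where open ≡-Reasoning

    couplingRowValue : CW-row problem' zero P ≡ s ℚ.+ ι (+ Δ) ℚ.* Σℚ k q
    couplingRowValue = begin
      CW-row problem' zero P
        ≡⟨ cong₂ ℚ._+_ (zeros-· (proj₁ P)) (·-++ couplingRow zeros (proj₂ P)) ⟩
      0ℚ ℚ.+ ((ι (+ 1) ℚ.* s ℚ.+ (constΔ ++ zeros) · (λ v → proj₂ P (suc (v ↑ˡ n)))) ℚ.+ zeros · x)
        ≡⟨ cong (0ℚ ℚ.+_) (cong₂ ℚ._+_
             (cong (ι (+ 1) ℚ.* s ℚ.+_) (·-++ constΔ zeros (λ v → proj₂ P (suc (v ↑ˡ n))))) (zeros-· x)) ⟩
      0ℚ ℚ.+ ((ι (+ 1) ℚ.* s ℚ.+ (constΔ · q ℚ.+ zeros · r)) ℚ.+ 0ℚ)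
        ≡⟨ trans (ℚₚ.+-identityˡ _) (trans (ℚₚ.+-identityʳ _) (cong₂ ℚ._+_ (ℚₚ.*-identityˡ s)
             (trans (cong₂ ℚ._+_ (const-· (+ Δ) q) (zeros-· r)) (ℚₚ.+-identityʳ _)))) ⟩
      s ℚ.+ ι (+ Δ) ℚ.* Σℚ k q ∎
      where open ≡-Reasoning

    record ChainEquations : Set where
      field
        first    : q zero ℚ.+ x pivot ≡ ι (+ gap)
        chain    : ∀ j → q (suc j) ℚ.+ r (Fin.inject₁ j) ≡ ι (+ gap)
        pair     : ∀ j → q j ℚ.+ r j ≡ ι (+ gap)
        coupling : s ℚ.+ ι (+ Δ) ℚ.* Σℚ k q ≡ ι (+ gap')

    feasible-intro : LPFeasible problem (restrict P) → ChainEquations →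
      0ℚ ℚ.≤ s → (∀ j → 0ℚ ℚ.≤ q j) → (∀ j → 0ℚ ℚ.≤ r j) → LPFeasible problem' P
    feasible-intro old eqs 0≤s 0≤q 0≤r = lpFeasible
      (λ { zero → trans couplingRowValue coupling ; (suc i) → trans (oldCWRow i P) (eqCW i) })
      (++-elim (λ t → TM-row problem' t P ≡ ι ((newb ++ b problem) t))
        (λ i → trans (newRows i) (cong ι (sym (lookup-++ˡ newb (b problem) i))))
        (λ t → trans (oldRow t P) (trans (eqTM t) (cong ι (sym (lookup-++ʳ newb (b problem) t))))))
      lowY uppY
      (nonNegative⇒lowX problem' ((λ _ → refl) , (λ _ → refl)) {x = proj₂ P} (++-elim _
        (λ { zero → 0≤s ; (suc v) → ++-elim (λ v → 0ℚ ℚ.≤ proj₂ P (suc (v ↑ˡ n))) 0≤q 0≤r v })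
        (lowX⇒nonNegative problem standardBounds lowX)))
      (noUpperBound problem' ((λ _ → refl) , (λ _ → refl)) {x = proj₂ P})
      where
      open LPFeasible old
      open ChainEquations eqs
      chainRows-hold : ∀ (i : Fin k) → TM-row problem' ((i ↑ˡ k) ↑ˡ m) P ≡ ι (+ gap)
      chainRows-hold zero    = trans firstRow first
      chainRows-hold (suc j) = trans (chainRow j) (chain j)
      newRows : ∀ i → TM-row problem' (i ↑ˡ m) P ≡ ι (+ gap)
      newRows = ++-elim {k} {k} _ chainRows-hold (λ j → trans (pairRow j) (pair j))

    feasible-elim : LPFeasible problem' P → LPFeasible problem (restrict P) × ChainEquations
    feasible-elim new = old , eqs
      where
      open LPFeasible new
      old : LPFeasible problem (restrict P)
      old = lpFeasible
        (λ i → trans (sym (oldCWRow i P)) (eqCW (suc i)))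
        (λ t → trans (sym (oldRow t P))
                 (trans (eqTM ((k + k) ↑ʳ t)) (cong ι (lookup-++ʳ newb (b problem) t))))
        lowY uppY
        (nonNegative⇒lowX problem standardBounds {x = x} (λ i → lowX (oldVar i)))
        (noUpperBound problem standardBounds {x = x})
      newRows : ∀ i → TM-row problem' (i ↑ˡ m) P ≡ ι (+ gap)
      newRows i = trans (eqTM (i ↑ˡ m)) (cong ι (lookup-++ˡ newb (b problem) i))
      eqs : ChainEquations
      eqs = record
        { first    = trans (sym firstRow) (newRows zero)
        ; chain    = λ j → trans (sym (chainRow j)) (newRows (suc j ↑ˡ k))
        ; pair     = λ j → trans (sym (pairRow j)) (newRows (k ↑ʳ j))
        ; coupling = trans (sym couplingRowValue) (eqCW zero)
        }

  vertexNew : Fin (suc (k + k)) → ℚ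
  vertexNew = ι (+ gap') ∷ ((λ (_ : Fin k) → 0ℚ) ++ (λ (_ : Fin k) → ι (+ gap)))

  witnessNew : Fin (suc (k + k)) → ℤ
  witnessNew = + 0 ∷ ((λ (_ : Fin k) → + gap) ++ zeros {k})

  vertex' : Point p (suc (k + k) + n)
  vertex' = proj₁ vertex , (vertexNew ++ proj₂ vertex)

  witness' : IntPoint p (suc (k + k) + n)
  witness' = proj₁ witness , (witnessNew ++ proj₂ witness)

  vertex'-old : ∀ i → proj₂ vertex' (oldVar i) ≡ proj₂ vertex i
  vertex'-old = lookup-++ʳ vertexNew (proj₂ vertex)

  vertex'-q : ∀ j → proj₂ vertex' (qVar j) ≡ 0ℚ
  vertex'-q j = trans (lookup-++ˡ vertexNew (proj₂ vertex) (suc (j ↑ˡ k)))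
                      (lookup-++ˡ (λ (_ : Fin k) → 0ℚ) (λ (_ : Fin k) → ι (+ gap)) j)

  vertex'-r : ∀ j → proj₂ vertex' (rVar j) ≡ ι (+ gap)
  vertex'-r j = trans (lookup-++ˡ vertexNew (proj₂ vertex) (suc (k ↑ʳ j)))
                      (lookup-++ʳ (λ (_ : Fin k) → 0ℚ) (λ (_ : Fin k) → ι (+ gap)) j)

  witness'-old : ∀ i → proj₂ witness' (oldVar i) ≡ proj₂ witness i
  witness'-old = lookup-++ʳ witnessNew (proj₂ witness)

  witness'-q : ∀ j → proj₂ witness' (qVar j) ≡ + gap
  witness'-q j = trans (lookup-++ˡ witnessNew (proj₂ witness) (suc (j ↑ˡ k)))
                       (lookup-++ˡ (λ (_ : Fin k) → + gap) (zeros {k}) j)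

  witness'-r : ∀ j → proj₂ witness' (rVar j) ≡ + 0
  witness'-r j = trans (lookup-++ˡ witnessNew (proj₂ witness) (suc (k ↑ʳ j)))
                       (lookup-++ʳ (λ (_ : Fin k) → + gap) (zeros {k}) j)

  coupling-at-gap : ι (+ Δ) ℚ.* Σℚ k (λ _ → ι (+ gap)) ≡ ι (+ gap')
  coupling-at-gap = begin
    ι (+ Δ) ℚ.* Σℚ k (λ _ → ι (+ gap))  ≡⟨ cong (ι (+ Δ) ℚ.*_) (Σℚ-const-ι k gap) ⟩
    ι (+ Δ) ℚ.* ι (+ (k * gap))         ≡⟨ sym (ι-homo-ℕ* Δ (k * gap)) ⟩
    ι (+ (Δ * (k * gap)))               ≡⟨ cong (λ z → ι (+ z)) (x∙yz≈y∙xz Δ k gap) ⟩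
    ι (+ gap')                          ∎
    where open ≡-Reasoning

  vertex'-feasible : LPFeasible problem' vertex'
  vertex'-feasible = feasible-intro vertex'
    (LPFeasible-cong problem (λ _ → refl) (λ i → sym (vertex'-old i)) (proj₁ isVertex))
    (record
      { first    = trans (cong₂ ℚ._+_ (vertex'-q zero) (trans (vertex'-old pivot) vertex-pivot)) (ℚₚ.+-identityˡ _)
      ; chain    = λ j → trans (cong₂ ℚ._+_ (vertex'-q (suc j)) (vertex'-r (Fin.inject₁ j))) (ℚₚ.+-identityˡ _)
      ; pair     = λ j → trans (cong₂ ℚ._+_ (vertex'-q j) (vertex'-r j)) (ℚₚ.+-identityˡ _)
      ; coupling = trans (cong (ι (+ gap') ℚ.+_)
                     (trans (cong (ι (+ Δ) ℚ.*_) (Σℚ-zero k vertex'-q)) (ℚₚ.*-zeroʳ (ι (+ Δ)))))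
                     (ℚₚ.+-identityʳ _)
      })
    (0≤ι+ gap')
    (λ j → subst (0ℚ ℚ.≤_) (sym (vertex'-q j)) ℚₚ.≤-refl)
    (λ j → subst (0ℚ ℚ.≤_) (sym (vertex'-r j)) (0≤ι+ gap))

  witness'-feasible : IntFeasible problem' witness'
  witness'-feasible = feasible-intro (embed witness')
    (LPFeasible-cong problem (λ _ → refl) (λ i → cong ι (sym (witness'-old i))) witnessFeasible)
    (record
      { first    = trans (cong₂ ℚ._+_ (cong ι (witness'-q zero))
                     (cong ι (trans (witness'-old pivot) (integral-pivot witness witnessFeasible))))
                     (ℚₚ.+-identityʳ _)
      ; chain    = λ j → trans (cong₂ ℚ._+_ (cong ι (witness'-q (suc j))) (cong ι (witness'-r (Fin.inject₁ j))))
                     (ℚₚ.+-identityʳ _)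
      ; pair     = λ j → trans (cong₂ ℚ._+_ (cong ι (witness'-q j)) (cong ι (witness'-r j))) (ℚₚ.+-identityʳ _)
      ; coupling = trans (ℚₚ.+-identityˡ _)
                     (trans (cong (ι (+ Δ) ℚ.*_) (Σℚ-cong k (λ j → cong ι (witness'-q j)))) coupling-at-gap)
      })
    ℚₚ.≤-refl
    (λ j → subst (λ z → 0ℚ ℚ.≤ ι z) (sym (witness'-q j)) (0≤ι+ gap))
    (λ j → subst (λ z → 0ℚ ℚ.≤ ι z) (sym (witness'-r j)) ℚₚ.≤-refl)

  isVertex' : IsLPVertex problem' vertex'
  isVertex' = vertex'-feasible , unique
    where
    unique : ∀ P R → LPFeasible problem' P → LPFeasible problem' R → IsMidpoint vertex' P R → SamePoint P R
    unique P R fP fR (midY , midX) = proj₁ old-same , sameX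
      where
      module EP = ChainEquations (proj₂ (feasible-elim P fP))
      module ER = ChainEquations (proj₂ (feasible-elim R fR))
      old-same : SamePoint (restrict P) (restrict R)
      old-same = proj₂ isVertex (restrict P) (restrict R)
        (proj₁ (feasible-elim P fP)) (proj₁ (feasible-elim R fR))
        (midY , (λ i → trans (sym (vertex'-old i)) (midX (oldVar i))))
      SameAt : Fin k → Set
      SameAt j = (proj₂ P (qVar j) ≡ proj₂ R (qVar j)) × (proj₂ P (rVar j) ≡ proj₂ R (rVar j))
      sameAt : ∀ j → SameAt j
      sameAt = <-weakInduction SameAt (q₀≡ , rightSummand-unique (EP.pair zero) (ER.pair zero) q₀≡)
        λ j (_ , r≡) → let q≡ = leftSummand-unique (EP.chain j) (ER.chain j) r≡
                       in q≡ , rightSummand-unique (EP.pair (suc j)) (ER.pair (suc j)) q≡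
        where
        q₀≡ : proj₂ P (qVar zero) ≡ proj₂ R (qVar zero)
        q₀≡ = leftSummand-unique EP.first ER.first (proj₂ old-same pivot)
      s≡ : proj₂ P zero ≡ proj₂ R zero
      s≡ = leftSummand-unique EP.coupling ER.coupling (cong (ι (+ Δ) ℚ.*_) (Σℚ-cong k (λ j → proj₁ (sameAt j))))
      sameX : ∀ i → proj₂ P i ≡ proj₂ R i
      sameX = ++-elim {suc (k + k)} _
        (λ { zero → s≡ ; (suc v) → ++-elim {k} {k} (λ v → proj₂ P (suc (v ↑ˡ n)) ≡ proj₂ R (suc (v ↑ˡ n)))
                                     (λ j → proj₁ (sameAt j)) (λ j → proj₂ (sameAt j)) v })
        (proj₂ old-same)

  integral-pivot' : ∀ w → IntFeasible problem' w → proj₂ w zero ≡ + 0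
  integral-pivot' w fw = ι-injective s≡0
    where
    open ChainEquations (proj₂ (feasible-elim (embed w) fw))
    q r : Fin k → ℚ
    q j = ι (proj₂ w (qVar j))
    r j = ι (proj₂ w (rVar j))
    x-pivot≡0 : ι (proj₂ w (oldVar pivot)) ≡ 0ℚ
    x-pivot≡0 = cong ι (integral-pivot (proj₁ w , (λ i → proj₂ w (oldVar i)))
                                        (proj₁ (feasible-elim (embed w) fw)))
    r≡0 : ∀ j → q j ≡ ι (+ gap) → r j ≡ 0ℚ
    r≡0 j q≡D = rightSummand-unique (pair j) (ℚₚ.+-identityʳ _) q≡D
    Forced : Fin k → Set
    Forced j = (q j ≡ ι (+ gap)) × (r j ≡ 0ℚ)
    forced : ∀ j → Forced j
    forced = <-weakInduction Forced (q₀≡D , r≡0 zero q₀≡D)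
      λ j (_ , r≡) → let q≡D = leftSummand-unique (chain j) (ℚₚ.+-identityʳ _) r≡
                     in q≡D , r≡0 (suc j) q≡D
      where
      q₀≡D : q zero ≡ ι (+ gap)
      q₀≡D = leftSummand-unique first (ℚₚ.+-identityʳ _) x-pivot≡0
    s≡0 : ι (proj₂ w zero) ≡ 0ℚ
    s≡0 = leftSummand-unique coupling (trans (ℚₚ.+-identityˡ _) coupling-at-gap)
            (cong (ι (+ Δ) ℚ.*_) (Σℚ-cong k (λ j → proj₁ (forced j))))

  newM-column : ∀ v → ∥ (λ i → newM i v) ∥₁ ≡ ∥ (λ j → chainRows j v) ∥₁ ℤ.+ ∥ (λ j → pairRows j v) ∥₁
  newM-column v = trans (∥∥₁-cong (λ i → ++-column chainRows pairRows i v))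
                        (∥++∥₁ (λ j → chainRows j v) (λ j → pairRows j v))

  newM-zeroColumn : ∥ (λ i → newM i zero) ∥₁ ≡ + 0
  newM-zeroColumn = trans (newM-column zero) (cong₂ ℤ._+_ (∥zeros∥₁ k) (∥zeros∥₁ k))

  predIndicator-column : ∀ j' → ∥ (λ j → predIndicator j j') ∥₁ ℤ.≤ + 1
  predIndicator-column j' = ℤₚ.≤-trans (ℤₚ.≤-reflexive (ℤₚ.+-identityˡ _)) (indicator-inject₁-column j')

  newM-columns : ∀ v → ∥ (λ i → newM i v) ∥₁ ℤ.≤ + 2
  newM-columns zero    = ℤₚ.≤-trans (ℤₚ.≤-reflexive newM-zeroColumn) (ℤ.+≤+ ℕ.z≤n)
  newM-columns (suc u) = ++-elim {k} {k} (λ u → ∥ (λ i → newM i (suc u)) ∥₁ ℤ.≤ + 2)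
    (λ j' → ℤₚ.≤-reflexive (trans (newM-column (suc (j' ↑ˡ k))) (cong₂ ℤ._+_
      (trans (∥∥₁-cong (λ j → lookup-++ˡ (indicator j) (predIndicator j) j')) (∥indicator-column∥₁ j'))
      (trans (∥∥₁-cong (λ j → lookup-++ˡ (indicator j) (indicator j) j')) (∥indicator-column∥₁ j')))))
    (λ j' → ℤₚ.≤-trans (ℤₚ.≤-reflexive (trans (newM-column (suc (k ↑ʳ j'))) (cong₂ ℤ._+_
      (∥∥₁-cong (λ j → lookup-++ʳ (indicator j) (predIndicator j) j'))
      (trans (∥∥₁-cong (λ j → lookup-++ʳ (indicator j) (indicator j) j')) (∥indicator-column∥₁ j')))))
      (ℤₚ.+-monoˡ-≤ (+ 1) (predIndicator-column j')))
    u

  pivotColumn≤1' : ∥ (λ r → M problem' r zero) ∥₁ ℤ.≤ + 1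
  pivotColumn≤1' = ℤₚ.≤-trans
    (ℤₚ.≤-reflexive (trans (blockUpper-leftColumn newM tieRows (M problem) zero) newM-zeroColumn))
    (ℤ.+≤+ ℕ.z≤n)

  coefficients' : CoeffsIn01Δ Δ problem'
  coefficients' = C∈ , W∈ , T∈ , extendM-∈01Δ newM newM∈
    where
    C∈ : ∀ i j → In01Δ Δ (C problem' i j)
    C∈ zero    j = zero∈01Δ
    C∈ (suc i) j = proj₁ coefficients i j
    couplingRow∈ : ∀ v → In01Δ Δ (couplingRow v)
    couplingRow∈ zero    = one∈01Δ
    couplingRow∈ (suc v) = ++-all (In01Δ Δ) {f = constΔ} {g = zeros} (λ _ → Δ∈01Δ) (λ _ → zero∈01Δ) v
    W∈ : ∀ i j → In01Δ Δ (W problem' i j)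
    W∈ zero    = ++-all (In01Δ Δ) {f = couplingRow} {g = zeros} couplingRow∈ (λ _ → zero∈01Δ)
    W∈ (suc i) = ++-all (In01Δ Δ) {f = zeros} (λ _ → zero∈01Δ) (proj₁ (proj₂ coefficients) i)
    T∈ : ∀ r j → In01Δ Δ (T problem' r j)
    T∈ = ++-all (λ A → ∀ j → In01Δ Δ (A j)) {f = newTRows} {g = T problem}
      (λ _ _ → zero∈01Δ) (proj₁ (proj₂ (proj₂ coefficients)))
    predIndicator∈ : ∀ j j' → In01Δ Δ (predIndicator j j')
    predIndicator∈ zero    _ = zero∈01Δ
    predIndicator∈ (suc j)   = indicator∈01Δ (Fin.inject₁ j)
    chain∈ : ∀ j v → In01Δ Δ (chainRows j v)
    chain∈ j zero    = zero∈01Δ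
    chain∈ j (suc v) = ++-all (In01Δ Δ) {f = indicator j} {g = predIndicator j}
      (indicator∈01Δ j) (predIndicator∈ j) v
    pair∈ : ∀ j v → In01Δ Δ (pairRows j v)
    pair∈ j zero    = zero∈01Δ
    pair∈ j (suc v) = ++-all (In01Δ Δ) {f = indicator j} {g = indicator j}
      (indicator∈01Δ j) (indicator∈01Δ j) v
    newM∈ : ∀ i v → In01Δ Δ (newM i v)
    newM∈ = ++-all (λ A → ∀ v → In01Δ Δ (A v)) {f = chainRows} {g = pairRows} chain∈ pair∈

  hardInstance : HardInstance Δ p (suc h) (k + k + m) (suc (k + k) + n)
  hardInstance = record
    { problem = problem' ; pivot = zero ; gap = gap'
    ; vertex = vertex' ; witness = witness'
    ; columns≤2 = extendM-columns≤2 newM newM-columns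
    ; pivotColumn≤1 = pivotColumn≤1'
    ; standardBounds = (λ _ → refl) , (λ _ → refl)
    ; coefficients = coefficients'
    ; isVertex = isVertex'
    ; witnessFeasible = witness'-feasible
    ; vertex-pivot = refl
    ; integral-pivot = integral-pivot'
    }

gap≤dist∞ : ∀ {Δ p h m n} (H : HardInstance Δ p h m n) → let open HardInstance H in
  ∀ w → IntFeasible problem w → ι (+ gap) ℚ.≤ dist∞ (embed w) vertex
gap≤dist∞ {p = p} {n = n} H w fw = subst (ℚ._≤ dist∞ (embed w) vertex) pivot-distance
  (ℚₚ.p≤q⇒p≤r⊔q (maxℚ p (λ j → ℚ.∣ ι (proj₁ w j) ℚ.- proj₁ vertex j ∣))
                (maxℚ-upper n (λ i → ℚ.∣ ι (proj₂ w i) ℚ.- proj₂ vertex i ∣) pivot))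
  where
  open HardInstance H
  maxℚ-upper : ∀ k (f : Fin k → ℚ) i → f i ℚ.≤ maxℚ k f
  maxℚ-upper (suc k) f zero    = ℚₚ.p≤p⊔q (f zero) _
  maxℚ-upper (suc k) f (suc i) = ℚₚ.p≤q⇒p≤r⊔q (f zero) (maxℚ-upper k (λ j → f (suc j)) i)
  pivot-distance : ℚ.∣ ι (proj₂ w pivot) ℚ.- proj₂ vertex pivot ∣ ≡ ι (+ gap)
  pivot-distance = begin
    ℚ.∣ ι (proj₂ w pivot) ℚ.- proj₂ vertex pivot ∣
      ≡⟨ cong₂ (λ a z → ℚ.∣ ι a ℚ.- z ∣) (integral-pivot w fw) vertex-pivot ⟩
    ℚ.∣ 0ℚ ℚ.- ι (+ gap) ∣
      ≡⟨ cong ℚ.∣_∣ (ℚₚ.+-identityˡ (ℚ.- ι (+ gap))) ⟩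
    ℚ.∣ ℚ.- ι (+ gap) ∣
      ≡⟨ ℚₚ.∣-p∣≡∣p∣ (ι (+ gap)) ⟩
    ℚ.∣ ι (+ gap) ∣
      ≡⟨ cong ℚ.∣_∣ (ι-mkℚ (+ gap)) ⟩
    ℚ.∣ mkℚ (+ gap) 0 (coprime-1 gap) ∣
      ≡⟨ sym (ι-mkℚ (+ gap)) ⟩
    ι (+ gap) ∎
    where open ≡-Reasoning

rows cols : (k p h : ℕ) → ℕ
rows k zero    zero    = suc (k + (k + k))
rows k zero    (suc h) = k + k + rows k zero h
rows k (suc p) h       = 3 + k + rows k p h
cols k zero    zero    = suc (k + (k + (k + k)))
cols k zero    (suc h) = suc (k + k) + cols k zero h
cols k (suc p) h       = 2 + k + cols k p h

hardFamily : (Δ k₀ p h : ℕ) → HardInstance Δ p h (rows (suc k₀) p h) (cols (suc k₀) p h)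
hardFamily Δ k₀ zero    zero    = BaseInstance.hardInstance Δ (suc k₀)
hardFamily Δ k₀ zero    (suc h) = AddCouplingRow.hardInstance k₀ (hardFamily Δ k₀ zero h)
hardFamily Δ k₀ (suc p) h       = AddIntegerVariable.hardInstance k₀ (hardFamily Δ k₀ p h)

gap-growth : ∀ Δ k L {D} → D ≡ k * (Δ * k) ^ L → k * (Δ * D) ≡ k * (Δ * k) ^ suc L
gap-growth Δ k L refl = cong (k *_) (sym (ℕₚ.*-assoc Δ k ((Δ * k) ^ L)))

hardFamily-gap : ∀ Δ k₀ p h → HardInstance.gap (hardFamily Δ k₀ p h) ≡ suc k₀ * (Δ * suc k₀) ^ (p + h)
hardFamily-gap Δ k₀ zero    zero    = sym (ℕₚ.*-identityʳ (suc k₀))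
hardFamily-gap Δ k₀ zero    (suc h) = gap-growth Δ (suc k₀) h (hardFamily-gap Δ k₀ zero h)
hardFamily-gap Δ k₀ (suc p) h       = gap-growth Δ (suc k₀) (p + h) (hardFamily-gap Δ k₀ p h)

sizeFactor : ℕ → ℕ
sizeFactor zero    = 5
sizeFactor (suc L) = 5 + sizeFactor L

module Sizes (k₀ : ℕ) where
  open +-*-Solver

  k : ℕ
  k = suc k₀

  ≤5k : ∀ {a} r → a + r ≡ 5 * k → a ≤ 5 * k
  ≤5k {a} r eq = subst (a ≤_) eq (ℕₚ.m≤m+n a r)

  ≤-step : ∀ {a x} B → a ≤ 5 * k → x ≤ B * k → a + x ≤ (5 + B) * k
  ≤-step B a≤ x≤ = ℕₚ.≤-trans (ℕₚ.+-mono-≤ a≤ x≤) (ℕₚ.≤-reflexive (sym (ℕₚ.*-distribʳ-+ k 5 B)))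

  rows≤ : ∀ p h → rows k p h ≤ sizeFactor (p + h) * k
  rows≤ zero zero = ≤5k (1 + 2 * k₀)
    (solve 1 (λ x → (con 1 :+ ((con 1 :+ x) :+ ((con 1 :+ x) :+ (con 1 :+ x)))) :+ (con 1 :+ con 2 :* x)
                    := con 5 :* (con 1 :+ x)) refl k₀)
  rows≤ zero (suc h) = ≤-step (sizeFactor h) (≤5k (3 + 3 * k₀)
    (solve 1 (λ x → ((con 1 :+ x) :+ (con 1 :+ x)) :+ (con 3 :+ con 3 :* x) := con 5 :* (con 1 :+ x)) refl k₀))
    (rows≤ zero h)
  rows≤ (suc p) h = ≤-step (sizeFactor (p + h)) (≤5k (1 + 4 * k₀)
    (solve 1 (λ x → (con 3 :+ (con 1 :+ x)) :+ (con 1 :+ con 4 :* x) := con 5 :* (con 1 :+ x)) refl k₀))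
    (rows≤ p h)

  cols≤ : ∀ p h → cols k p h ≤ sizeFactor (p + h) * k
  cols≤ zero zero = ≤5k k₀
    (solve 1 (λ x → (con 1 :+ ((con 1 :+ x) :+ ((con 1 :+ x) :+ ((con 1 :+ x) :+ (con 1 :+ x))))) :+ x
                    := con 5 :* (con 1 :+ x)) refl k₀)
  cols≤ zero (suc h) = ≤-step (sizeFactor h) (≤5k (2 + 3 * k₀)
    (solve 1 (λ x → (con 1 :+ ((con 1 :+ x) :+ (con 1 :+ x))) :+ (con 2 :+ con 3 :* x) := con 5 :* (con 1 :+ x)) refl k₀))
    (cols≤ zero h)
  cols≤ (suc p) h = ≤-step (sizeFactor (p + h)) (≤5k (2 + 4 * k₀)
    (solve 1 (λ x → (con 2 :+ (con 1 :+ x)) :+ (con 2 :+ con 4 :* x) := con 5 :* (con 1 :+ x)) refl k₀))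
    (cols≤ p h)

  k≤rows : ∀ p h → k ≤ rows k p h
  k≤rows zero    zero    = ℕₚ.m≤n⇒m≤1+n (ℕₚ.m≤m+n k (k + k))
  k≤rows zero    (suc h) = ℕₚ.m≤n⇒m≤o+n (k + k) (k≤rows zero h)
  k≤rows (suc p) h       = ℕₚ.m≤n⇒m≤o+n (3 + k) (k≤rows p h)

  k≤cols : ∀ p h → k ≤ cols k p h
  k≤cols zero    zero    = ℕₚ.m≤n⇒m≤1+n (ℕₚ.m≤m+n k (k + (k + k)))
  k≤cols zero    (suc h) = ℕₚ.m≤n⇒m≤o+n (suc (k + k)) (k≤cols zero h)
  k≤cols (suc p) h       = ℕₚ.m≤n⇒m≤o+n (2 + k) (k≤cols p h)

  cols≤rows : ∀ p h → cols k p h ≤ sizeFactor (p + h) * rows k p h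
  cols≤rows p h = ℕₚ.≤-trans (cols≤ p h) (ℕₚ.*-monoʳ-≤ (sizeFactor (p + h)) (k≤rows p h))

  rows≤cols : ∀ p h → rows k p h ≤ sizeFactor (p + h) * cols k p h
  rows≤cols p h = ℕₚ.≤-trans (rows≤ p h) (ℕₚ.*-monoʳ-≤ (sizeFactor (p + h)) (k≤cols p h))

^-distrib-* : ∀ a b L → (a * b) ^ L ≡ a ^ L * b ^ L
^-distrib-* a b zero    = refl
^-distrib-* a b (suc L) = trans (cong ((a * b) *_) (^-distrib-* a b L)) (interchange a b (a ^ L) (b ^ L))

size-bound : ∀ Δ k m B L → m ≤ B * k → m * (Δ * m) ^ L ≤ B ^ suc L * (k * (Δ * k) ^ L)
size-bound Δ k m B L m≤Bk = begin
  m * (Δ * m) ^ L              ≤⟨ ℕₚ.*-mono-≤ m≤Bk (ℕₚ.^-monoˡ-≤ L (ℕₚ.*-monoʳ-≤ Δ m≤Bk)) ⟩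
  B * k * (Δ * (B * k)) ^ L    ≡⟨ cong (λ z → B * k * z ^ L) (x∙yz≈y∙xz Δ B k) ⟩
  B * k * (B * (Δ * k)) ^ L    ≡⟨ cong (B * k *_) (^-distrib-* B (Δ * k) L) ⟩
  B * k * (B ^ L * (Δ * k) ^ L) ≡⟨ interchange B k (B ^ L) ((Δ * k) ^ L) ⟩
  B ^ suc L * (k * (Δ * k) ^ L) ∎
  where open ℕₚ.≤-Reasoning

1/suc : ℕ → ℚ
1/suc a = mkℚ (+ 1) a (Coprimality.1-coprimeTo (suc a))

0<1/suc : ∀ a → 0ℚ ℚ.< 1/suc a
0<1/suc a = ℚ.*<* (ℤ.+<+ (ℕ.s≤s ℕ.z≤n))

1/suc-*-≤ : ∀ a X Y → X ≤ a * Y → 1/suc a ℚ.* ι (+ X) ℚ.≤ ι (+ Y)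
1/suc-*-≤ a X Y X≤aY = begin
  1/suc a ℚ.* ι (+ X)                    ≤⟨ ℚₚ.*-monoˡ-≤-nonNeg (1/suc a) (ι-mono-≤ (ℤ.+≤+ X≤[1+a]Y)) ⟩
  1/suc a ℚ.* ι (+ (suc a * Y))          ≡⟨ cong (1/suc a ℚ.*_) (ι-homo-ℕ* (suc a) Y) ⟩
  1/suc a ℚ.* (ι (+ suc a) ℚ.* ι (+ Y))  ≡⟨ sym (ℚₚ.*-assoc (1/suc a) (ι (+ suc a)) (ι (+ Y))) ⟩
  (1/suc a ℚ.* ι (+ suc a)) ℚ.* ι (+ Y)  ≡⟨ cong (ℚ._* ι (+ Y)) inverse ⟩
  1ℚ ℚ.* ι (+ Y)                         ≡⟨ ℚₚ.*-identityˡ _ ⟩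
  ι (+ Y)                                ∎
  where
  open ℚₚ.≤-Reasoning
  X≤[1+a]Y : X ≤ suc a * Y
  X≤[1+a]Y = ℕₚ.≤-trans X≤aY (ℕₚ.m≤n+m (a * Y) Y)
  inverse : 1/suc a ℚ.* ι (+ suc a) ≡ 1ℚ
  inverse = trans (cong (1/suc a ℚ.*_) (ι-mkℚ (+ suc a))) (ℚₚ.*-inverseˡ (mkℚ (+ suc a) 0 (coprime-1 (suc a))))

≤-*-ι : ∀ a X Y → X ≤ a * Y → ι (+ X) ℚ.≤ ι (+ suc a) ℚ.* ι (+ Y)
≤-*-ι a X Y X≤aY = subst (ι (+ X) ℚ.≤_) (ι-homo-ℕ* (suc a) Y)
  (ι-mono-≤ (ℤ.+≤+ (ℕₚ.≤-trans X≤aY (ℕₚ.m≤n+m (a * Y) Y))))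

proposition14 :
    (p h : ℕ) →
    Σ ℚ λ K → (0ℚ <ℚ K) ×
    ((Δ : ℕ) → 1 ≤ Δ →
      Σ ℚ λ c₁ → Σ ℚ λ c₂ → (0ℚ <ℚ c₁) × (0ℚ <ℚ c₂) ×
      ((N : ℕ) →
        Σ ℕ λ m → Σ ℕ λ n → (N ≤ m) ×
        (c₁ *ℚ ℕ→ℚ n ≤ℚ ℕ→ℚ m) × (ℕ→ℚ m ≤ℚ c₂ *ℚ ℕ→ℚ n) ×
        Σ (Instance p h m n) λ I →
          MColumnsNorm≤2 I × ZeroLowerNoUpper I × CoeffsIn01Δ Δ I ×
          Σ (Point p n) λ z → IsLPVertex I z ×
            (Σ (IntPoint p n) λ w → IntFeasible I w) ×
            ((w : IntPoint p n) → IntFeasible I w →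
              K *ℚ ℕ→ℚ (m * (Δ * m) ^ (p + h)) ≤ℚ dist∞ (embed w) z)))
-- With k = N + 1 copies, m and n lie between k and B k, so the gap k (Δk)^(p+h) is at
-- least m (Δm)^(p+h) / B^(p+h+1).  The construction works for every Δ, so 1 ≤ Δ is unused.
proposition14 p h =
  1/suc (B ^ suc (p + h)) , 0<1/suc _ , λ Δ _ →
  1/suc B , ι (+ suc B) , 0<1/suc B , 0<ι+suc B , λ N →
    let open HardInstance (hardFamily Δ N p h)
        open Sizes N
        m : ℕ
        m = rows k p h
    in m , cols k p h , ℕₚ.≤-trans (ℕₚ.n≤1+n N) (k≤rows p h)
     , 1/suc-*-≤ B _ _ (cols≤rows p h) , ≤-*-ι B _ _ (rows≤cols p h)
     , problem , columns≤2 , standardBounds , coefficients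
     , vertex , isVertex , (witness , witnessFeasible)
     , λ w fw → ℚₚ.≤-trans
         (1/suc-*-≤ _ _ gap (subst (m * (Δ * m) ^ (p + h) ≤_)
           (cong (B ^ suc (p + h) *_) (sym (hardFamily-gap Δ N p h)))
           (size-bound Δ k m B (p + h) (rows≤ p h))))
         (gap≤dist∞ (hardFamily Δ N p h) w fw)
  where
  B : ℕ
  B = sizeFactor (p + h)
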